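{- Let $G_1$ and $G_2$ be disjoint simple graphs of order $m\geq 1$ and $n\geq 2$, respectively, such that $G_2$ has a Hamiltonian path, and let $G=G_1+G_2$. If $m\leq 2n$ then the double vertex graph $F_2(G)$ is Hamiltonian, and if $m\leq 2(n-1)$ then the complete double vertex graph $M_2(G)$ is Hamiltonian.
   Context: For a graph $G$, the double vertex graph $F_2(G)$ is the graph whose vertices are the $2$-element subsets of $V(G)$, two such vertices being adjacent if their symmetric difference is $\{a,b\}$ for some edge $ab$ of $G$. The complete double vertex graph $M_2(G)$ is the graph whose vertices are the $2$-element multisubsets of $V(G)$ (unordered pairs $\{x,y\}$ with $x=y$ allowed), two such multisets being adjacent if their symmetric difference as multisets is $\{a,b\}$ for some edge $ab$ of $G$ (equivalently, they are $\{x,a\}$ and $\{x,b\}$ with $ab\in E(G)$). The join $G_1+G_2$ of disjoint graphs has vertex set $V(G_1)\cup V(G_2)$ and edge set $E(G_1)\cup E(G_2)\cup\{uv: u\in V(G_1), v\in V(G_2)\}$. A graph is Hamiltonian if it has a cycle through every vertex exactly once; a Hamiltonian path is a path through every vertex exactly once. -}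

module Defs where

open import Data.Nat using (ℕ; zero; suc; _+_)
open import Data.Fin using (Fin; splitAt; inject₁; fromℕ; _<_; _≤_)
open import Data.Sum using (_⊎_; inj₁; inj₂)
open import Data.Product using (Σ; ∃; _×_; _,_; proj₁; proj₂; ∃-syntax)
open import Data.Unit using (⊤)
open import Relation.Nullary using (¬_)
open import Relation.Binary.PropositionalEquality using (_≡_)
open import Function.Bundles using (Bijection)

record Graph (n : ℕ) : Set₁ where
  field
    Adj    : Fin n → Fin n → Set
    sym    : ∀ {x y} → Adj x y → Adj y x
    irrefl : ∀ {x} → ¬ Adj x x
open Graph public

Listing : ℕ → Set → Set
Listing k V = Bijection (Data.Fin.Properties.≡-setoid k) (Relation.Binary.PropositionalEquality.setoid V)
  where import Data.Fin.Properties
        import Relation.Binary.PropositionalEquality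

HamiltonianPath : {V : Set} → (V → V → Set) → Set
HamiltonianPath {V} R =
  Σ ℕ λ j → Σ (Listing (suc j) V) λ f →
    ∀ (i : Fin j) → R (Bijection.to f (inject₁ i)) (Bijection.to f (Fin.suc i))

-- Hamiltonian cycle: a bijective listing v₀,…,v_j (j ≥ 2, i.e. at least 3
-- vertices) of all vertices with vᵢ R vᵢ₊₁ and v_j R v₀.
Hamiltonian : {V : Set} → (V → V → Set) → Set
Hamiltonian {V} R =
  Σ ℕ λ j → 2 Data.Nat.≤ j × Σ (Listing (suc j) V) λ f →
    (∀ (i : Fin j) → R (Bijection.to f (inject₁ i)) (Bijection.to f (Fin.suc i)))
    × R (Bijection.to f (fromℕ j)) (Bijection.to f Fin.zero)

JoinAdj : ∀ {m n} → Graph m → Graph n → Fin (m + n) → Fin (m + n) → Set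
JoinAdj {m} G₁ G₂ x y with splitAt m x | splitAt m y
... | inj₁ a | inj₁ b = Adj G₁ a b
... | inj₂ a | inj₂ b = Adj G₂ a b
... | inj₁ _ | inj₂ _ = ⊤
... | inj₂ _ | inj₁ _ = ⊤

SamePair : ∀ {N} → Fin N → Fin N → Fin N → Fin N → Set
SamePair x y x' y' = (x ≡ x' × y ≡ y') ⊎ (x ≡ y' × y ≡ x')

-- Vertices of F₂(G): 2-element subsets {x,y}, represented canonically with x < y.
F₂V : ℕ → Set
F₂V N = Σ (Fin N × Fin N) λ p → proj₁ p < proj₂ p

-- Vertices of M₂(G): 2-element multisubsets {x,y}, canonically with x ≤ y.
M₂V : ℕ → Set
M₂V N = Σ (Fin N × Fin N) λ p → proj₁ p ≤ proj₂ p

-- Two (multi)pairs {x,y}, {x',y'} are adjacent iff they are {c,a} and {c,b}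
-- with ab an edge (i.e. their multiset symmetric difference is {a,b}).
PairAdj : ∀ {N} → (Fin N → Fin N → Set) → Fin N → Fin N → Fin N → Fin N → Set
PairAdj {N} R x y x' y' =
  ∃[ c ] ∃[ a ] ∃[ b ] R a b × SamePair x y c a × SamePair x' y' c b

F₂Adj : ∀ {N} → (Fin N → Fin N → Set) → F₂V N → F₂V N → Set
F₂Adj R ((x , y) , _) ((x' , y') , _) = PairAdj R x y x' y'

M₂Adj : ∀ {N} → (Fin N → Fin N → Set) → M₂V N → M₂V N → Set
M₂Adj R ((x , y) , _) ((x' , y') , _) = PairAdj R x y x' y'

module Submission where

-- We therefore build the
-- cycles in a symbolic model: vertices aᵢ (constructor A) and bⱼ (constructor
-- B), edges aᵢbⱼ and bⱼbⱼ₊₁, and a vertex {u,v} of the pair graph is a "code"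
-- (u , v).  For i < m-1 a block aᵢb₀ → aᵢb₁ → … → aᵢb_{n-1} whose gaps
--      are either path steps or bounces aᵢbₖ → aᵢaⱼ → aᵢbₖ₊₁; consecutive
--      blocks are linked through aᵢaᵢ₊₁.  The last block a_{m-1} instead
--      threads the pairs bⱼbₖ through its gaps and finally returns to a₀b₀.
--      The remaining pairs aₓa_y are distributed over the first m-1 blocks so
--      that each block gets at most n-1 of them; this is where m ≤ 2n
--      (m ≤ 2(n-1) for M₂, whose diagonal pairs aᵢaᵢ also need a bounce) is used.
--   3. Counting: every canonical code occurs exactly once on the cycle, and
--      (under the bound on m) every code on it is canonical.
--   4. Interpretation: the model embeds into G₁ + G₂ along the Hamiltonian path
--      of G₂, and the theorem follows by transport.

open import Defs
open import Data.Nat using (ℕ; _≤_; _*_; _∸_; _+_)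
open import Data.Product using (_×_)

open import Data.Nat as ℕ using (zero; suc; _<_; z≤n; s≤s)
import Data.Nat.Properties as ℕP
open import Data.Fin as F using (Fin; inject₁; fromℕ; toℕ; fromℕ<; _↑ˡ_; _↑ʳ_; splitAt; join)
import Data.Fin.Properties as FP
open import Data.List using (List; []; _∷_; _++_; length; lookup; concat; map; replicate; [_])
import Data.List.Properties as LP
open import Data.List.Relation.Unary.All as All using (All; []; _∷_)
open import Data.List.Relation.Unary.All.Properties using (++⁺; ++⁻ˡ; ++⁻ʳ)
open import Data.Product using (Σ; ∃; _,_; proj₁; proj₂)
open import Data.Product.Properties using (≡-dec)
open import Data.Sum using (_⊎_; inj₁; inj₂)
open import Data.Unit using (tt)
open import Data.Empty using (⊥-elim)
open import Relation.Binary using (DecidableEquality; tri<; tri≈; tri>)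
open import Relation.Binary.PropositionalEquality
  using (_≡_; _≢_; refl; cong; cong₂; trans; subst; subst₂) renaming (sym to ≡-sym)
open import Relation.Nullary using (¬_; Dec; yes; no)
open import Function.Bundles using (Bijection)

module Walks {V : Set} (R : V → V → Set) where

  data Walk : V → V → List V → Set where
    wnil  : ∀ {u} → Walk u u (u ∷ [])
    wcons : ∀ {u x v xs} → R u x → Walk x v xs → Walk u v (u ∷ xs)

  _▸_∙_ : ∀ {u v x y xs ys} → Walk u v xs → R v x → Walk x y ys → Walk u y (xs ++ ys)
  wnil ▸ r ∙ w = wcons r w
  wcons r' w' ▸ r ∙ w = wcons r' (w' ▸ r ∙ w)

  walk-steps : ∀ {u v rest} → Walk u v (u ∷ rest) → (i : Fin (length rest)) →
               R (lookup (u ∷ rest) (inject₁ i)) (lookup (u ∷ rest) (F.suc i))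
  walk-steps (wcons r wnil) F.zero = r
  walk-steps (wcons r (wcons r' w)) F.zero = r
  walk-steps (wcons r (wcons r' w)) (F.suc i) = walk-steps (wcons r' w) i

  walk-end : ∀ {u v rest} → Walk u v (u ∷ rest) → lookup (u ∷ rest) (fromℕ (length rest)) ≡ v
  walk-end wnil = refl
  walk-end (wcons r wnil) = refl
  walk-end (wcons r (wcons r' w)) = walk-end (wcons r' w)

  walk-first : ∀ {u w L} {P : V → Set} → Walk u w L → All P L → P u
  walk-first wnil (h ∷ _) = h
  walk-first (wcons _ _) (h ∷ _) = h

  walk-last : ∀ {u w L} {P : V → Set} → Walk u w L → All P L → P w
  walk-last wnil (h ∷ []) = h
  walk-last (wcons r wk) (h ∷ hs) = walk-last wk hs

module _ {V W : Set} {R : V → V → Set} {S : W → W → Set} (φ : V → W) (P : V → Set)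
         (φ-adj : ∀ {c d} → R c d → P c → P d → S (φ c) (φ d)) where
  open Walks

  map-walk : ∀ {u w L} → Walk R u w L → All P L → Walk S (φ u) (φ w) (map φ L)
  map-walk wnil (h ∷ []) = wnil
  map-walk (wcons r wk) (h ∷ hs) = wcons (φ-adj r h (walk-first R wk hs)) (map-walk wk hs)

module Occurrences {V : Set} (_≟_ : DecidableEquality V) where

  occ : V → List V → ℕ
  occ v [] = 0
  occ v (x ∷ xs) with v ≟ x
  ... | yes _ = suc (occ v xs)
  ... | no _ = occ v xs

  occ-++ : ∀ v xs ys → occ v (xs ++ ys) ≡ occ v xs + occ v ys
  occ-++ v [] ys = refl
  occ-++ v (x ∷ xs) ys with v ≟ x
  ... | yes _ = cong suc (occ-++ v xs ys)
  ... | no _ = occ-++ v xs ys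

  occ-here : ∀ v xs → occ v (v ∷ xs) ≡ suc (occ v xs)
  occ-here v xs with v ≟ v
  ... | yes _ = refl
  ... | no ne = ⊥-elim (ne refl)

  occ-skip : ∀ {v x} xs → v ≢ x → occ v (x ∷ xs) ≡ occ v xs
  occ-skip {v} {x} xs ne with v ≟ x
  ... | yes e = ⊥-elim (ne e)
  ... | no _ = refl

  occ-lookup : ∀ xs (i : Fin (length xs)) → 1 ≤ occ (lookup xs i) xs
  occ-lookup (x ∷ xs) F.zero rewrite occ-here x xs = s≤s z≤n
  occ-lookup (x ∷ xs) (F.suc i) with lookup xs i ≟ x
  ... | yes _ = ℕP.≤-trans (occ-lookup xs i) (ℕP.n≤1+n _)
  ... | no _ = occ-lookup xs i

  occ-repeat : ∀ xs (i j : Fin (length xs)) → lookup xs i ≡ lookup xs j → i ≢ j →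
               2 ≤ occ (lookup xs i) xs
  occ-repeat (x ∷ xs) F.zero F.zero e ne = ⊥-elim (ne refl)
  occ-repeat (x ∷ xs) F.zero (F.suc j) e ne rewrite occ-here x xs =
    s≤s (subst (λ z → 1 ≤ occ z xs) (≡-sym e) (occ-lookup xs j))
  occ-repeat (x ∷ xs) (F.suc i) F.zero e ne with lookup xs i ≟ x
  ... | yes _ = s≤s (occ-lookup xs i)
  ... | no ¬p = ⊥-elim (¬p e)
  occ-repeat (x ∷ xs) (F.suc i) (F.suc j) e ne with lookup xs i ≟ x
  ... | yes _ = ℕP.≤-trans (occ-repeat xs i j e (λ q → ne (cong F.suc q))) (ℕP.n≤1+n _)
  ... | no _ = occ-repeat xs i j e (λ q → ne (cong F.suc q))

  occ-find : ∀ v xs → 1 ≤ occ v xs → Σ (Fin (length xs)) λ i → lookup xs i ≡ v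
  occ-find v (x ∷ xs) h with v ≟ x
  ... | yes p = F.zero , ≡-sym p
  ... | no _ with occ-find v xs h
  ... | i , e = F.suc i , e

  listing : ∀ xs → (∀ v → occ v xs ≡ 1) → Listing (length xs) V
  listing xs once = record
    { to = lookup xs
    ; cong = cong (lookup xs)
    ; bijective = injective , surjective }
    where
    injective : ∀ {i j} → lookup xs i ≡ lookup xs j → i ≡ j
    injective {i} {j} e with i F.≟ j
    ... | yes p = p
    ... | no ne with ℕP.≤-trans (occ-repeat xs i j e ne) (ℕP.≤-reflexive (once (lookup xs i)))
    ... | s≤s ()
    surjective : ∀ y → ∃ λ x → ∀ {z} → z ≡ x → lookup xs z ≡ y
    surjective y with occ-find y xs (ℕP.≤-reflexive (≡-sym (once y)))
    ... | i , e = i , λ { refl → e }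

module _ {V : Set} (R : V → V → Set) (_≟_ : DecidableEquality V) where
  open Walks R
  open Occurrences _≟_

  hamiltonian-from-closed-walk : ∀ {u v L} → Walk u v L → R v u →
    (∀ z → occ z L ≡ 1) → 3 ≤ length L → Hamiltonian R
  hamiltonian-from-closed-walk wnil r once (s≤s ())
  hamiltonian-from-closed-walk {u} (wcons {xs = rest} r' w) r once (s≤s len) =
    length rest , len , listing (u ∷ rest) once , walk-steps (wcons r' w) ,
    subst (λ z → R z u) (≡-sym (walk-end (wcons r' w))) r

record Tour {C : Set} (R : C → C → Set) (_≟_ : DecidableEquality C) (Can : C → Set) : Set where
  field
    start finish : C
    stops        : List C
    walk         : Walks.Walk R start finish stops
    closing      : R finish start
    canonical    : All Can stops
    once         : ∀ c → Can c → Occurrences.occ _≟_ c stops ≡ 1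
    long         : 3 ≤ length stops

-- Among the codes C only
-- those satisfying Can stand for vertices; enc maps them bijectively onto V
-- (with inverse dec) and maps code adjacency to adjacency in V.
module Transport {C V : Set} (_≟C_ : DecidableEquality C) (_≟V_ : DecidableEquality V)
  {RC : C → C → Set} {RV : V → V → Set} {Can : C → Set}
  (enc : C → V) (dec : V → C)
  (dec-enc : ∀ {c} → Can c → dec (enc c) ≡ c)
  (enc-dec : ∀ v → enc (dec v) ≡ v)
  (can-dec : ∀ v → Can (dec v))
  (enc-adj : ∀ {c d} → RC c d → Can c → Can d → RV (enc c) (enc d)) where
  open Walks RC
  open Occurrences

  occ-map-enc : ∀ v L → All Can L → occ _≟V_ v (map enc L) ≡ occ _≟C_ (dec v) L
  occ-map-enc v [] [] = refl
  occ-map-enc v (c ∷ L) (h ∷ hs) with v ≟V enc c | dec v ≟C c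
  ... | yes _ | yes _ = cong suc (occ-map-enc v L hs)
  ... | no _ | no _ = occ-map-enc v L hs
  ... | yes e | no ne = ⊥-elim (ne (trans (cong dec e) (dec-enc h)))
  ... | no ne | yes e = ⊥-elim (ne (trans (≡-sym (enc-dec v)) (cong enc e)))

  transport-hamiltonian : Tour RC _≟C_ Can → Hamiltonian RV
  transport-hamiltonian t =
    hamiltonian-from-closed-walk RV _≟V_ (map-walk enc Can enc-adj walk canonical)
      (enc-adj closing (walk-last walk canonical) (walk-first walk canonical))
      (λ v → trans (occ-map-enc v stops canonical) (once (dec v) (can-dec v)))
      (subst (3 ≤_) (≡-sym (LP.length-map enc stops)) long)
    where open Tour t

-- Symbolic vertices: aᵢ (a vertex of G₁) and bⱼ (the j-th vertex of the
-- Hamiltonian path of G₂).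
data Vtx : Set where
  A B : ℕ → Vtx

A-inj : ∀ {i j} → A i ≡ A j → i ≡ j
A-inj refl = refl

B-inj : ∀ {i j} → B i ≡ B j → i ≡ j
B-inj refl = refl

_≟v_ : DecidableEquality Vtx
A i ≟v A j with i ℕ.≟ j
... | yes p = yes (cong A p)
... | no p = no (λ q → p (A-inj q))
A i ≟v B j = no (λ ())
B i ≟v A j = no (λ ())
B i ≟v B j with i ℕ.≟ j
... | yes p = yes (cong B p)
... | no p = no (λ q → p (B-inj q))

-- A code (u , v) stands for the pair {u,v}; several codes may denote the same pair.
Code : Set
Code = Vtx × Vtx

_≟c_ : DecidableEquality Code
_≟c_ = ≡-dec _≟v_ _≟v_

data Edge : Vtx → Vtx → Set where
  ab-edge   : ∀ {i j} → Edge (A i) (B j)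
  ba-edge   : ∀ {i j} → Edge (B j) (A i)
  up-edge   : ∀ {j} → Edge (B j) (B (suc j))
  down-edge : ∀ {j} → Edge (B (suc j)) (B j)

SameCode : Code → Code → Set
SameCode (p , q) (c , a) = (p ≡ c × q ≡ a) ⊎ (p ≡ a × q ≡ c)

CodeAdj : Code → Code → Set
CodeAdj x y = ∃ λ z → ∃ λ a → ∃ λ b → Edge a b × SameCode x (z , a) × SameCode y (z , b)

-- The four ways of moving one entry of a code along an edge; the suffix tells
-- on which side (Left/Right) the fixed entry z sits before and after the move.
sLL : ∀ {z a b} → Edge a b → CodeAdj (z , a) (z , b)
sLL e = _ , _ , _ , e , inj₁ (refl , refl) , inj₁ (refl , refl)

sLR : ∀ {z a b} → Edge a b → CodeAdj (z , a) (b , z)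
sLR e = _ , _ , _ , e , inj₁ (refl , refl) , inj₂ (refl , refl)

sRL : ∀ {z a b} → Edge a b → CodeAdj (a , z) (z , b)
sRL e = _ , _ , _ , e , inj₂ (refl , refl) , inj₁ (refl , refl)

sRR : ∀ {z a b} → Edge a b → CodeAdj (a , z) (b , z)
sRR e = _ , _ , _ , e , inj₂ (refl , refl) , inj₂ (refl , refl)

open Walks CodeAdj public
open Occurrences _≟c_ public

data CanF (m' q : ℕ) : Code → Set where
  cAA : ∀ {x y} → x < y → y < suc m' → CanF m' q (A x , A y)
  cAB : ∀ {x y} → x < suc m' → y < suc q → CanF m' q (A x , B y)
  cBB : ∀ {x y} → x < y → y < suc q → CanF m' q (B x , B y)

data CanM (m' q : ℕ) : Code → Set where
  cAA : ∀ {x y} → x ≤ y → y < suc m' → CanM m' q (A x , A y)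
  cAB : ∀ {x y} → x < suc m' → y < suc q → CanM m' q (A x , B y)
  cBB : ∀ {x y} → x ≤ y → y < suc q → CanM m' q (B x , B y)

data GapWalk : Code → List Code → Code → Set where
  gdir : ∀ {u v} → CodeAdj u v → GapWalk u [] v
  gvia : ∀ {u x g v} → CodeAdj u x → GapWalk x g v → GapWalk u (x ∷ g) v

gap-then-walk : ∀ {u g v w L} → GapWalk u g v → Walk v w L → Walk u w (u ∷ g ++ L)
gap-then-walk (gdir r) w = wcons r w
gap-then-walk (gvia r gw) w = wcons r (gap-then-walk gw w)

gap-++ : ∀ {u g x g' v} → GapWalk u g x → GapWalk x g' v → GapWalk u (g ++ x ∷ g') v
gap-++ (gdir r) h = gvia r h
gap-++ (gvia r k) h = gvia r (gap-++ k h)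

walk-then-gap : ∀ {s u L g v} → Walk s u L → GapWalk u g v → Σ Code λ l → Walk s l (L ++ g) × CodeAdj l v
walk-then-gap {s} {u} {L} {[]} w (gdir r) = u , subst (Walk s u) (≡-sym (LP.++-identityʳ L)) w , r
walk-then-gap {s} {u} {L} {x ∷ g} w (gvia r k) with walk-then-gap (w ▸ r ∙ wnil) k
... | l , w' , r' = l , subst (Walk s l) (LP.++-assoc L (x ∷ []) g) w' , r'

ab : ℕ → ℕ → Code
ab i j = (A i , B j)

block : ℕ → ℕ → List (List Code) → List Code
block i k [] = ab i k ∷ []
block i k (g ∷ gs) = ab i k ∷ (g ++ block i (suc k) gs)

blockEnd : ℕ → List (List Code) → ℕ
blockEnd k [] = k
blockEnd k (_ ∷ gs) = blockEnd (suc k) gs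

blockEnd-length : ∀ k gs → blockEnd k gs ≡ k + length gs
blockEnd-length k [] = ≡-sym (ℕP.+-identityʳ k)
blockEnd-length k (g ∷ gs) = trans (blockEnd-length (suc k) gs) (≡-sym (ℕP.+-suc k (length gs)))

data Gaps (i : ℕ) : ℕ → List (List Code) → Set where
  gnil : ∀ {k} → Gaps i k []
  gcons : ∀ {k g gs} → GapWalk (ab i k) g (ab i (suc k)) → Gaps i (suc k) gs → Gaps i k (g ∷ gs)

block-walk : ∀ {i k gs} → Gaps i k gs → Walk (ab i k) (ab i (blockEnd k gs)) (block i k gs)
block-walk gnil = wnil
block-walk (gcons g gs) = gap-then-walk g (block-walk gs)

-- The codes aᵢa_y and aₓaᵢ, through which the block of aᵢ can bounce:
-- aᵢbₖ → aᵢa_y → aᵢbₖ₊₁.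
data Bouncer (i : ℕ) : Code → Set where
  bL : ∀ y → Bouncer i (A i , A y)
  bR : ∀ x → Bouncer i (A x , A i)

bounce-gap : ∀ {i k c} → Bouncer i c → GapWalk (ab i k) (c ∷ []) (ab i (suc k))
bounce-gap (bL y) = gvia (sLL ba-edge) (gdir (sLL ab-edge))
bounce-gap (bR x) = gvia (sLR ba-edge) (gdir (sRL ab-edge))

step-gap : ∀ {i k} → GapWalk (ab i k) [] (ab i (suc k))
step-gap = gdir (sLL up-edge)

paddedGaps : ℕ → List Code → List (List Code)
paddedGaps r os = map [_] os ++ replicate r []

paddedGaps-ok : ∀ {i k} r os → All (Bouncer i) os → Gaps i k (paddedGaps r os)
paddedGaps-ok zero [] [] = gnil
paddedGaps-ok (suc r) [] [] = gcons step-gap (paddedGaps-ok r [] [])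
paddedGaps-ok r (o ∷ os) (b ∷ bs) = gcons (bounce-gap b) (paddedGaps-ok r os bs)

paddedGaps-length : ∀ r os → length (paddedGaps r os) ≡ length os + r
paddedGaps-length r os = trans (LP.length-++ (map [_] os)) (cong₂ _+_ (LP.length-map [_] os) (LP.length-replicate r))

concat-paddedGaps : ∀ r os → concat (paddedGaps r os) ≡ os
concat-paddedGaps r [] = concat-empties r
  where
  concat-empties : ∀ r → concat (replicate {A = List Code} r []) ≡ []
  concat-empties zero = refl
  concat-empties (suc r) = concat-empties r
concat-paddedGaps r (o ∷ os) = cong (o ∷_) (concat-paddedGaps r os)

-- Parity bookkeeping: the pairs aₓa_y are distributed according to the
-- parity of y - x, and the closing snake of M₂ depends on the parity of n.
double : ℕ → ℕ
double zero = zero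
double (suc t) = suc (suc (double t))

half : ℕ → ℕ
half zero = zero
half (suc zero) = zero
half (suc (suc n)) = suc (half n)

data Parity : ℕ → Set where
  even : ∀ h → Parity (double h)
  odd  : ∀ h → Parity (suc (double h))

parity : ∀ n → Parity n
parity zero = even zero
parity (suc zero) = odd zero
parity (suc (suc n)) with parity n
... | even h = even (suc h)
... | odd h = odd (suc h)

2*≡double : ∀ x → 2 * x ≡ double x
2*≡double zero = refl
2*≡double (suc x) = trans (cong suc (ℕP.+-suc x (x + 0))) (cong (λ z → suc (suc z)) (2*≡double x))

double-+ : ∀ a b → double (a + b) ≡ double a + double b
double-+ zero b = refl
double-+ (suc a) b = cong (λ z → suc (suc z)) (double-+ a b)

double-mono : ∀ {a b} → a ≤ b → double a ≤ double b
double-mono z≤n = z≤n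
double-mono (s≤s h) = s≤s (s≤s (double-mono h))

double≤1+double⇒≤ : ∀ a b → double a ≤ suc (double b) → a ≤ b
double≤1+double⇒≤ zero b h = z≤n
double≤1+double⇒≤ (suc a) (suc b) (s≤s (s≤s h)) = s≤s (double≤1+double⇒≤ a b h)

double≤double⇒≤ : ∀ a b → double a ≤ double b → a ≤ b
double≤double⇒≤ a b h = double≤1+double⇒≤ a b (ℕP.m≤n⇒m≤1+n h)

double-injective : ∀ a b → double a ≡ double b → a ≡ b
double-injective zero zero e = refl
double-injective (suc a) (suc b) e = cong suc (double-injective a b (ℕP.suc-injective (ℕP.suc-injective e)))

double≢odd : ∀ a b → double a ≢ suc (double b)
double≢odd zero b ()
double≢odd (suc a) zero ()
double≢odd (suc a) (suc b) e = double≢odd a b (ℕP.suc-injective (ℕP.suc-injective e))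

double+≢suc : ∀ t b → double t + b ≢ suc b
double+≢suc zero b = ℕP.<⇒≢ (ℕP.n<1+n b)
double+≢suc (suc t) b e = ℕP.<⇒≢ (s≤s (ℕP.m≤n+m b (double t))) (≡-sym (ℕP.suc-injective e))

double-half : ∀ z → double (half z) ≤ z
double-half zero = z≤n
double-half (suc zero) = z≤n
double-half (suc (suc z)) = s≤s (s≤s (double-half z))

half-lt : ∀ s z → double s + 2 ≤ z → s < half z
half-lt zero (suc (suc z)) h = s≤s z≤n
half-lt zero (suc zero) (s≤s ())
half-lt (suc s) (suc (suc z)) (s≤s (s≤s h)) = s≤s (half-lt s z h)

split≤ : ∀ g h → g ≤ h → Σ ℕ λ d → h ≡ d + g
split≤ g h le = h ∸ g , ≡-sym (ℕP.m∸n+n≡m le)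

2+≤⇒≢ : ∀ {a b} → suc (suc a) ≤ b → a ≢ b
2+≤⇒≢ h e = ℕP.<-irrefl e (ℕP.<-trans (ℕP.n<1+n _) h)

2+≤⇒1+≢ : ∀ {a b} → suc (suc a) ≤ b → suc a ≢ b
2+≤⇒1+≢ h e = ℕP.<-irrefl e h

-- The codes bounced through by the block of aⱼ (j < m') in F₂: the top pair
-- aⱼa_{m'} (if m' ≥ j+2), the forward pairs aⱼa_{j+3}, aⱼa_{j+5}, … below
-- a_{m'}, and the backward pairs a_{j-2}aⱼ, a_{j-4}aⱼ, ….
topPair : ℕ → ℕ → List Code
topPair m' j with suc (suc j) ℕ.≤? m'
... | yes _ = (A j , A m') ∷ []
... | no _ = []

forwardPairs : ℕ → ℕ → ℕ → List Code
forwardPairs j a zero = []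
forwardPairs j a (suc k) = (A j , A a) ∷ forwardPairs j (suc (suc a)) k

backwardPairs : ℕ → ℕ → List Code
backwardPairs j (suc (suc z)) = (A z , A j) ∷ backwardPairs j z
backwardPairs j _ = []

-- The number of forward pairs of aⱼ: those aⱼa_y with y = j+3, j+5, … ≤ m'.
forwardCount : ℕ → ℕ → ℕ
forwardCount m' j = half (suc m' ∸ (3 + j))

ownedF : ℕ → ℕ → List Code
ownedF m' j = topPair m' j ++ (forwardPairs j (3 + j) (forwardCount m' j) ++ backwardPairs j j)

ownedM : ℕ → ℕ → List Code
ownedM m' j = ownedF m' j ++ ((A j , A j) ∷ [])

topPair-bounce : ∀ m' j → All (Bouncer j) (topPair m' j)
topPair-bounce m' j with suc (suc j) ℕ.≤? m'
... | yes _ = bL m' ∷ []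
... | no _ = []

forwardPairs-bounce : ∀ j a k → All (Bouncer j) (forwardPairs j a k)
forwardPairs-bounce j a zero = []
forwardPairs-bounce j a (suc k) = bL a ∷ forwardPairs-bounce j (suc (suc a)) k

backwardPairs-bounce : ∀ j z → All (Bouncer j) (backwardPairs j z)
backwardPairs-bounce j (suc (suc z)) = bR z ∷ backwardPairs-bounce j z
backwardPairs-bounce j zero = []
backwardPairs-bounce j (suc zero) = []

ownedF-bounce : ∀ m' j → All (Bouncer j) (ownedF m' j)
ownedF-bounce m' j = ++⁺ (topPair-bounce m' j) (++⁺ (forwardPairs-bounce j _ _) (backwardPairs-bounce j j))

ownedM-bounce : ∀ m' j → All (Bouncer j) (ownedM m' j)
ownedM-bounce m' j = ++⁺ (ownedF-bounce m' j) (bL j ∷ [])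

-- The first blocks: the block of aᵢ bounces once through each code of os i and
-- is padded with path steps to n' gaps; consecutive blocks are linked through
-- aᵢaᵢ₊₁ (aᵢb_{end} → aᵢaᵢ₊₁ → aᵢ₊₁b₀).
module Blocks (os : ℕ → List Code) (osb : ∀ j → All (Bouncer j) (os j)) (n' : ℕ) where
  gapsOf : ℕ → List (List Code)
  gapsOf i = paddedGaps (n' ∸ length (os i)) (os i)

  blocks : ℕ → ℕ → List Code
  blocks i zero = []
  blocks i (suc d) = block i 0 (gapsOf i) ++ ((A i , A (suc i)) ∷ blocks (suc i) d)

  blocks-walk : ∀ i d {v L} → Walk (ab (d + i) 0) v L → Walk (ab i 0) v (blocks i d ++ L)
  blocks-walk i zero w = w
  blocks-walk i (suc d) {v} {L} w =
    subst (Walk (ab i 0) v) (≡-sym (LP.++-assoc (block i 0 (gapsOf i)) _ L))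
      (block-walk (paddedGaps-ok _ (os i) (osb i)) ▸ sLL ba-edge ∙
        wcons (sRL ab-edge) (blocks-walk (suc i) d (subst (λ z → Walk (ab z 0) v L) (≡-sym (ℕP.+-suc d i)) w)))

row : ℕ → ℕ → List Code
row j zero = []
row j (suc f) = (B j , B (suc f + j)) ∷ row j f

rowGaps : ℕ → ℕ → List (List Code)
rowGaps k zero = []
rowGaps k (suc f) = row k (suc f) ∷ rowGaps (suc k) f

row-gap-to : ∀ k f {v} → CodeAdj (B k , B (suc k)) v → GapWalk (B k , B (suc f + k)) (row k f) v
row-gap-to k zero r = gdir r
row-gap-to k (suc f) r = gvia (sLL down-edge) (row-gap-to k f r)

row-gap : ∀ w k f → GapWalk (ab w k) (row k (suc f)) (ab w (suc k))
row-gap w k f = gvia (sRL ab-edge) (row-gap-to k f (sRR ba-edge))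

rowGaps-ok : ∀ w k f → Gaps w k (rowGaps k f)
rowGaps-ok w k zero = gnil
rowGaps-ok w k (suc f) = gcons (row-gap w k f) (rowGaps-ok w (suc k) f)

lastGapsF : ℕ → List (List Code)
lastGapsF p = [] ∷ rowGaps 1 p

closingF : ℕ → List Code
closingF p = row 0 (suc p)

closingF-gap : ∀ w p → GapWalk (ab w (suc p + 0)) (closingF p) (ab 0 0)
closingF-gap w p = gvia (sRR ab-edge) (row-gap-to 0 p (sLR ba-edge))

square : ℕ → List Code
square k = (B k , B k) ∷ (B k , B (suc k)) ∷ (B (suc k) , B (suc k)) ∷ []

square-gap : ∀ w k → GapWalk (ab w k) (square k) (ab w (suc k))
square-gap w k = gvia (sRL ab-edge) (gvia (sLL up-edge) (gvia (sRL up-edge) (gdir (sLR ba-edge))))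

mutual
  squareGaps : ℕ → ℕ → List (List Code)
  squareGaps k zero = []
  squareGaps k (suc f) = square k ∷ stepGaps (suc k) f

  stepGaps : ℕ → ℕ → List (List Code)
  stepGaps k zero = []
  stepGaps k (suc f) = [] ∷ squareGaps (suc k) f

mutual
  squareGaps-ok : ∀ w k f → Gaps w k (squareGaps k f)
  squareGaps-ok w k zero = gnil
  squareGaps-ok w k (suc f) = gcons (square-gap w k) (stepGaps-ok w (suc k) f)

  stepGaps-ok : ∀ w k f → Gaps w k (stepGaps k f)
  stepGaps-ok w k zero = gnil
  stepGaps-ok w k (suc f) = gcons step-gap (squareGaps-ok w (suc k) f)

lastGapsM : ℕ → ℕ → List (List Code)
lastGapsM w p = ((A w , A w) ∷ []) ∷ squareGaps 1 p

lastGapsM-ok : ∀ w p → Gaps w 0 (lastGapsM w p)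
lastGapsM-ok w p = gcons (bounce-gap (bL w)) (squareGaps-ok w 1 p)

colUp : ℕ → ℕ → ℕ → List Code
colUp L j zero = []
colUp L j (suc f) = (B (suc j) , B L) ∷ colUp L (suc j) f

colDown : ℕ → ℕ → List Code
colDown L zero = []
colDown L (suc j) = (B j , B L) ∷ colDown L j

-- The snake of h covers the pairs bₓb_y with y ≤ 2h missed by the squares:
-- it climbs column 2h, steps to b_{2h-2}b_{2h-1}, descends column 2h-1, and
-- recurses; it ends next to a₀b₀.
snakeHead : ℕ → Code
snakeHead zero = (B 0 , B 0)
snakeHead (suc h) = (B 0 , B (suc (suc (double h))))

snakeTail : ℕ → List Code
snakeTail zero = []
snakeTail (suc h) = colUp (suc (suc (double h))) 0 (double h) ++
  ((B (double h) , B (suc (double h))) ∷ (colDown (suc (double h)) (double h) ++ (snakeHead h ∷ snakeTail h)))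

snake : ℕ → List Code
snake h = snakeHead h ∷ snakeTail h

colUp-gap : ∀ L j f {v} → CodeAdj (B (f + j) , B L) v → GapWalk (B j , B L) (colUp L j f) v
colUp-gap L j zero r = gdir r
colUp-gap L j (suc f) {v} r = gvia (sRR up-edge) (colUp-gap L (suc j) f (subst (λ z → CodeAdj (B z , B L) v) (≡-sym (ℕP.+-suc f j)) r))

colDown-gap : ∀ L j {v} → CodeAdj (B 0 , B L) v → GapWalk (B j , B L) (colDown L j) v
colDown-gap L zero r = gdir r
colDown-gap L (suc j) r = gvia (sRR down-edge) (colDown-gap L j r)

to-snakeHead : ∀ h → CodeAdj (B 0 , B (suc (double h))) (snakeHead h)
to-snakeHead zero = sLL down-edge
to-snakeHead (suc h) = sLL down-edge

snake-gap : ∀ h → GapWalk (snakeHead h) (snakeTail h) (ab 0 0)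
snake-gap zero = gdir (sLR ba-edge)
snake-gap (suc h) =
  gap-++ (colUp-gap _ 0 (double h) (subst (λ z → CodeAdj (B z , B (suc (suc (double h)))) (B (double h) , B (suc (double h))))
                                          (≡-sym (ℕP.+-identityʳ (double h))) (sLL down-edge)))
  (gap-++ (colDown-gap _ (double h) (to-snakeHead h)) (snake-gap h))

closingM : ℕ → List Code
closingM n' with parity n'
... | even zero = []
... | even (suc h) = snake (suc h)
... | odd h = (B (suc (double h)) , B (suc (double h))) ∷ colDown (suc (double h)) (suc (double h)) ++ snake h

closingM-gap : ∀ w n' → 1 ≤ n' → GapWalk (ab w n') (closingM n') (ab 0 0)
closingM-gap w n' n'≥1 with parity n'
closingM-gap w .0 () | even zero
... | even (suc h) = gvia (sRR ab-edge) (snake-gap (suc h))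
... | odd h = gvia (sRL ab-edge) (gvia (sRR down-edge) (gap-++ (colDown-gap _ (double h) (to-snakeHead h)) (snake-gap h)))

rowGaps-length : ∀ k f → length (rowGaps k f) ≡ f
rowGaps-length k zero = refl
rowGaps-length k (suc f) = cong suc (rowGaps-length (suc k) f)

mutual
  squareGaps-length : ∀ k f → length (squareGaps k f) ≡ f
  squareGaps-length k zero = refl
  squareGaps-length k (suc f) = cong suc (stepGaps-length (suc k) f)

  stepGaps-length : ∀ k f → length (stepGaps k f) ≡ f
  stepGaps-length k zero = refl
  stepGaps-length k (suc f) = cong suc (squareGaps-length (suc k) f)

lastPieceF : ℕ → ℕ → List Code
lastPieceF m' p = block m' 0 (lastGapsF p) ++ closingF p

lastGapsF-end : ∀ p → blockEnd 0 (lastGapsF p) ≡ suc p + 0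
lastGapsF-end p = trans (blockEnd-length 0 (lastGapsF p)) (trans (cong suc (rowGaps-length 1 p)) (≡-sym (ℕP.+-identityʳ (suc p))))

lastPieceF-walk : ∀ m' p → Σ Code λ l → Walk (ab m' 0) l (lastPieceF m' p) × CodeAdj l (ab 0 0)
lastPieceF-walk m' p =
  walk-then-gap (subst (λ z → Walk (ab m' 0) (ab m' z) (block m' 0 (lastGapsF p))) (lastGapsF-end p)
                       (block-walk (gcons step-gap (rowGaps-ok m' 1 p))))
                (closingF-gap m' p)

lastPieceM : ℕ → ℕ → List Code
lastPieceM m' p = block m' 0 (lastGapsM m' p) ++ closingM (suc p)

lastGapsM-end : ∀ m' p → blockEnd 0 (lastGapsM m' p) ≡ suc p
lastGapsM-end m' p = trans (blockEnd-length 0 (lastGapsM m' p)) (cong suc (squareGaps-length 1 p))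

lastPieceM-walk : ∀ m' p → Σ Code λ l → Walk (ab m' 0) l (lastPieceM m' p) × CodeAdj l (ab 0 0)
lastPieceM-walk m' p =
  walk-then-gap (subst (λ z → Walk (ab m' 0) (ab m' z) (block m' 0 (lastGapsM m' p))) (lastGapsM-end m' p)
                       (block-walk (lastGapsM-ok m' p)))
                (closingM-gap m' (suc p) (s≤s z≤n))

-- Counting.  On a route, the only codes aₓb_y are the block entries aᵢbₖ;
-- the codes in gaps are aₓa_y or bₓb_y ("non-AB").
occ-cons : ∀ c x L → occ c (x ∷ L) ≡ occ c (x ∷ []) + occ c L
occ-cons c x L = occ-++ c (x ∷ []) L

data NotAB : Code → Set where
  nAA : ∀ {i j} → NotAB (A i , A j)
  nBB : ∀ {i j} → NotAB (B i , B j)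

ab≢nonAB : ∀ {x y c} → NotAB c → (A x , B y) ≢ c
ab≢nonAB nAA ()
ab≢nonAB nBB ()

occ-notAB : ∀ {x y} L → All NotAB L → occ (A x , B y) L ≡ 0
occ-notAB [] [] = refl
occ-notAB (z ∷ L) (h ∷ hs) = trans (occ-skip L (ab≢nonAB h)) (occ-notAB L hs)

occ-excluded : ∀ {c} (P : Code → Set) L → All P L → ¬ P c → occ c L ≡ 0
occ-excluded P [] [] np = refl
occ-excluded {c} P (x ∷ L) (h ∷ hs) np = trans (occ-skip {c} {x} L (λ e → np (subst P (≡-sym e) h))) (occ-excluded P L hs np)

bouncer⇒nonAB : ∀ {i c} → Bouncer i c → NotAB c
bouncer⇒nonAB (bL y) = nAA
bouncer⇒nonAB (bR x) = nAA

block-nonAB : ∀ {c} i k gs → NotAB c → occ c (block i k gs) ≡ occ c (concat gs)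
block-nonAB {c} i k [] h = occ-skip {c} {ab i k} [] (λ e → ab≢nonAB h (≡-sym e))
block-nonAB {c} i k (g ∷ gs) h = trans (occ-skip {c} {ab i k} (g ++ block i (suc k) gs) (λ e → ab≢nonAB h (≡-sym e)))
  (trans (occ-++ c g _) (trans (cong (occ c g +_) (block-nonAB i (suc k) gs h)) (≡-sym (occ-++ c g (concat gs)))))

block-ab-other : ∀ {x y} i k gs → x ≢ i → All NotAB (concat gs) → occ (A x , B y) (block i k gs) ≡ 0
block-ab-other {x} {y} i k [] ne _ = occ-skip {A x , B y} {ab i k} [] (λ e → ne (A-inj (cong proj₁ e)))
block-ab-other {x} {y} i k (g ∷ gs) ne al =
  trans (occ-skip {A x , B y} {ab i k} (g ++ block i (suc k) gs) (λ e → ne (A-inj (cong proj₁ e))))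
  (trans (occ-++ (A x , B y) g _) (cong₂ _+_ (occ-notAB g (++⁻ˡ g al)) (block-ab-other i (suc k) gs ne (++⁻ʳ g al))))

block-ab-below : ∀ {x y} i k gs → y < k → All NotAB (concat gs) → occ (A x , B y) (block i k gs) ≡ 0
block-ab-below {x} {y} i k [] lt _ = occ-skip {A x , B y} {ab i k} [] (λ e → ℕP.<-irrefl (B-inj (cong proj₂ e)) lt)
block-ab-below {x} {y} i k (g ∷ gs) lt al =
  trans (occ-skip {A x , B y} {ab i k} (g ++ block i (suc k) gs) (λ e → ℕP.<-irrefl (B-inj (cong proj₂ e)) lt))
  (trans (occ-++ (A x , B y) g _) (cong₂ _+_ (occ-notAB g (++⁻ˡ g al)) (block-ab-below i (suc k) gs (ℕP.m<n⇒m<1+n lt) (++⁻ʳ g al))))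

block-ab-hit : ∀ {x y} k gs → k ≤ y → y ≤ blockEnd k gs → All NotAB (concat gs) → occ (A x , B y) (block x k gs) ≡ 1
block-ab-hit {x} {y} k [] h1 h2 _ with ℕP.≤-antisym h1 h2
... | refl = occ-here (ab x k) []
block-ab-hit {x} {y} k (g ∷ gs) h1 h2 al with k ℕ.≟ y
... | yes refl = trans (occ-here (ab x k) (g ++ block x (suc k) gs))
      (cong suc (trans (occ-++ (A x , B y) g _) (cong₂ _+_ (occ-notAB g (++⁻ˡ g al)) (block-ab-below x (suc k) gs ℕP.≤-refl (++⁻ʳ g al)))))
... | no ne = trans (occ-skip {A x , B y} {ab x k} (g ++ block x (suc k) gs) (λ e → ne (≡-sym (B-inj (cong proj₂ e)))))
      (trans (occ-++ (A x , B y) g _) (cong₂ _+_ (occ-notAB g (++⁻ˡ g al)) (block-ab-hit (suc k) gs (ℕP.≤∧≢⇒< h1 ne) h2 (++⁻ʳ g al))))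

module BlockCounts (os : ℕ → List Code) (osb : ∀ j → All (Bouncer j) (os j)) (n' : ℕ) where
  open Blocks os osb n'

  blockCount : Code → ℕ → ℕ
  blockCount c i = occ c (block i 0 (gapsOf i)) + occ c ((A i , A (suc i)) ∷ [])

  blockCount-suc : ∀ c i d → occ c (blocks i (suc d)) ≡ blockCount c i + occ c (blocks (suc i) d)
  blockCount-suc c i d = trans (occ-++ c (block i 0 (gapsOf i)) _)
    (trans (cong (occ c (block i 0 (gapsOf i)) +_) (occ-cons c _ (blocks (suc i) d)))
     (≡-sym (ℕP.+-assoc (occ c (block i 0 (gapsOf i))) _ _)))

  blocks-count-none : ∀ c i d → (∀ j → i ≤ j → j < d + i → blockCount c j ≡ 0) → occ c (blocks i d) ≡ 0
  blocks-count-none c i zero h = refl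
  blocks-count-none c i (suc d) h = trans (blockCount-suc c i d) (cong₂ _+_ (h i ℕP.≤-refl (s≤s (ℕP.m≤n+m i d)))
    (blocks-count-none c (suc i) d (λ j h1 h2 → h j (ℕP.<⇒≤ h1) (subst (j <_) (ℕP.+-suc d i) h2) )))

  blocks-count-one : ∀ c ℓ i d → i ≤ ℓ → ℓ < d + i → blockCount c ℓ ≡ 1 →
    (∀ j → i ≤ j → j < d + i → j ≢ ℓ → blockCount c j ≡ 0) → occ c (blocks i d) ≡ 1
  blocks-count-one c ℓ i zero h1 h2 h3 h4 = ⊥-elim (ℕP.<-irrefl refl (ℕP.≤-<-trans h1 h2))
  blocks-count-one c ℓ i (suc d) h1 h2 h3 h4 with i ℕ.≟ ℓ
  ... | yes refl = trans (blockCount-suc c i d) (cong₂ _+_ h3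
        (blocks-count-none c (suc i) d (λ j a b → h4 j (ℕP.<⇒≤ a) (subst (j <_) (ℕP.+-suc d i) b) (λ e → ℕP.<-irrefl (≡-sym e) a))))
  ... | no ne = trans (blockCount-suc c i d) (cong₂ _+_ (h4 i ℕP.≤-refl (s≤s (ℕP.m≤n+m i d)) ne)
        (blocks-count-one c ℓ (suc i) d (ℕP.≤∧≢⇒< h1 ne) (subst (ℓ <_) (≡-sym (ℕP.+-suc d i)) h2) h3
          (λ j a b → h4 j (ℕP.<⇒≤ a) (subst (j <_) (ℕP.+-suc d i) b))))

  owned-nonAB : ∀ j → All NotAB (concat (gapsOf j))
  owned-nonAB j = subst (All NotAB) (≡-sym (concat-paddedGaps _ (os j))) (All.map bouncer⇒nonAB (osb j))

  blockEnd-large : ∀ j → n' ≤ blockEnd 0 (gapsOf j)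
  blockEnd-large j = subst (n' ≤_) (≡-sym (trans (blockEnd-length 0 (gapsOf j)) (paddedGaps-length (n' ∸ length (os j)) (os j))))
    (ℕP.m≤n+m∸n n' (length (os j)))

  blockCount-ab-own : ∀ x y → y ≤ n' → blockCount (A x , B y) x ≡ 1
  blockCount-ab-own x y yn = cong₂ _+_ (block-ab-hit {x} {y} 0 (gapsOf x) z≤n (ℕP.≤-trans yn (blockEnd-large x)) (owned-nonAB x))
     (occ-skip {A x , B y} {A x , A (suc x)} [] (λ ()))

  blockCount-ab-other : ∀ x y j → j ≢ x → blockCount (A x , B y) j ≡ 0
  blockCount-ab-other x y j ne = cong₂ _+_ (block-ab-other {x} {y} j 0 (gapsOf j) (λ e → ne (≡-sym e)) (owned-nonAB j))
     (occ-skip {A x , B y} {A j , A (suc j)} [] (λ ()))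

  blockCount-aa : ∀ x y j → blockCount (A x , A y) j ≡ occ (A x , A y) (os j) + occ (A x , A y) ((A j , A (suc j)) ∷ [])
  blockCount-aa x y j = cong (_+ occ (A x , A y) ((A j , A (suc j)) ∷ []))
     (trans (block-nonAB {A x , A y} j 0 (gapsOf j) nAA) (cong (occ (A x , A y)) (concat-paddedGaps _ (os j))))

  blockCount-bb : ∀ x y j → blockCount (B x , B y) j ≡ 0
  blockCount-bb x y j = cong₂ _+_
    (trans (block-nonAB {B x , B y} j 0 (gapsOf j) nBB) (trans (cong (occ (B x , B y)) (concat-paddedGaps _ (os j)))
       (occ-excluded {B x , B y} (Bouncer j) _ (osb j) (λ ()))))
     (occ-skip {B x , B y} {A j , A (suc j)} [] (λ ()))

module Route (m' n' : ℕ) (os : ℕ → List Code) (osb : ∀ j → All (Bouncer j) (os j)) (lastPiece : List Code) where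
  open Blocks os osb n' public
  open BlockCounts os osb n' public

  route : List Code
  route = blocks 0 m' ++ lastPiece

  route-walk : (Σ Code λ l → Walk (ab m' 0) l lastPiece × CodeAdj l (ab 0 0)) →
    Σ Code λ l → Walk (ab 0 0) l route × CodeAdj l (ab 0 0)
  route-walk (l , w , r) = l , blocks-walk 0 m' (subst (λ z → Walk (ab z 0) l lastPiece) (≡-sym (ℕP.+-identityʳ m')) w) , r

  private
    below : ∀ {j} → j < m' + 0 → j < m'
    below = subst (_ <_) (ℕP.+-identityʳ m')

  route-last : ∀ c → (∀ j → j < m' → blockCount c j ≡ 0) → occ c lastPiece ≡ 1 → occ c route ≡ 1
  route-last c none last = trans (occ-++ c (blocks 0 m') lastPiece)
    (cong₂ _+_ (blocks-count-none c 0 m' (λ j _ jm → none j (below jm))) last)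

  route-block : ∀ c ℓ → ℓ < m' → blockCount c ℓ ≡ 1 → (∀ j → j < m' → j ≢ ℓ → blockCount c j ≡ 0) →
    occ c lastPiece ≡ 0 → occ c route ≡ 1
  route-block c ℓ ℓm own others last = trans (occ-++ c (blocks 0 m') lastPiece)
    (cong₂ _+_ (blocks-count-one c ℓ 0 m' z≤n (subst (ℓ <_) (≡-sym (ℕP.+-identityʳ m')) ℓm) own
                  (λ j _ jm → others j (below jm))) last)

  route-ab : ∀ x y → x ≤ m' → y ≤ n' → (x ≡ m' → occ (A x , B y) lastPiece ≡ 1) →
    (x ≢ m' → occ (A x , B y) lastPiece ≡ 0) → occ (A x , B y) route ≡ 1
  route-ab x y xm yn last-own last-other with x ℕ.≟ m'
  ... | yes e = route-last (A x , B y) (λ j jm → blockCount-ab-other x y j (λ jx → ℕP.<⇒≢ jm (trans jx e))) (last-own e)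
  ... | no ne = route-block (A x , B y) x (ℕP.≤∧≢⇒< xm ne) (blockCount-ab-own x y yn)
                  (λ j _ jx → blockCount-ab-other x y j jx) (last-other ne)

  route-bb : ∀ x y → occ (B x , B y) lastPiece ≡ 1 → occ (B x , B y) route ≡ 1
  route-bb x y = route-last (B x , B y) (λ j _ → blockCount-bb x y j)

aa-≢₁ : ∀ {x y j z : ℕ} → x ≢ j → ¬ (_≡_ {A = Code} (A x , A y) (A j , A z))
aa-≢₁ ne e = ne (A-inj (cong proj₁ e))
aa-≢₂ : ∀ {x y j z : ℕ} → y ≢ z → ¬ (_≡_ {A = Code} (A x , A y) (A j , A z))
aa-≢₂ ne e = ne (A-inj (cong proj₂ e))

topPair-hit : ∀ m' j → suc (suc j) ≤ m' → occ (A j , A m') (topPair m' j) ≡ 1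
topPair-hit m' j h with suc (suc j) ℕ.≤? m'
... | yes _ = occ-here (A j , A m') []
... | no np = ⊥-elim (np h)

topPair-miss : ∀ {x y} m' j → (A x , A y) ≢ (A j , A m') → occ (A x , A y) (topPair m' j) ≡ 0
topPair-miss {x} {y} m' j ne with suc (suc j) ℕ.≤? m'
... | yes _ = occ-skip {A x , A y} {A j , A m'} [] ne
... | no _ = refl

topPair-link : ∀ m' x → occ (A x , A (suc x)) (topPair m' x) ≡ 0
topPair-link m' x with suc (suc x) ℕ.≤? m'
... | yes h = occ-skip {A x , A (suc x)} {A x , A m'} [] (aa-≢₂ (λ e → ℕP.<-irrefl e h))
... | no _ = refl

forwardPairs-other : ∀ {x y} j a k → x ≢ j → occ (A x , A y) (forwardPairs j a k) ≡ 0
forwardPairs-other j a zero ne = refl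
forwardPairs-other {x} {y} j a (suc k) ne = trans (occ-skip {A x , A y} {A j , A a} _ (aa-≢₁ ne)) (forwardPairs-other j (suc (suc a)) k ne)

forwardPairs-below : ∀ {y} j a k → y < a → occ (A j , A y) (forwardPairs j a k) ≡ 0
forwardPairs-below j a zero lt = refl
forwardPairs-below {y} j a (suc k) lt = trans (occ-skip {A j , A y} {A j , A a} _ (aa-≢₂ (ℕP.<⇒≢ lt)))
  (forwardPairs-below j (suc (suc a)) k (ℕP.m<n⇒m<1+n (ℕP.m<n⇒m<1+n lt)))

forwardPairs-parity : ∀ j t b k → occ (A j , A (double t + b)) (forwardPairs j (suc b) k) ≡ 0
forwardPairs-parity j t b zero = refl
forwardPairs-parity j zero b (suc k) = trans (occ-skip {A j , A b} {A j , A (suc b)} _ (aa-≢₂ (double+≢suc 0 b)))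
  (forwardPairs-below j (suc (suc (suc b))) k (ℕP.m<n⇒m<1+n (ℕP.m<n⇒m<1+n (ℕP.n<1+n b))))
forwardPairs-parity j (suc t) b (suc k) = trans (occ-skip {A j , A (double (suc t) + b)} {A j , A (suc b)} _ (aa-≢₂ (double+≢suc (suc t) b)))
  (subst (λ z → occ (A j , A z) (forwardPairs j (suc (suc (suc b))) k) ≡ 0) e (forwardPairs-parity j t (suc (suc b)) k))
  where
  e : double t + suc (suc b) ≡ double (suc t) + b
  e = trans (ℕP.+-suc (double t) (suc b)) (cong suc (ℕP.+-suc (double t) b))

forwardPairs-hit : ∀ j t a k → t < k → occ (A j , A (double t + a)) (forwardPairs j a k) ≡ 1
forwardPairs-hit j zero a (suc k) lt = trans (occ-here (A j , A a) _)
  (cong suc (forwardPairs-below j (suc (suc a)) k (ℕP.m<n⇒m<1+n (ℕP.n<1+n a))))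
forwardPairs-hit j (suc t) a (suc k) (s≤s lt) = trans
  (occ-skip {A j , A (double (suc t) + a)} {A j , A a} _ (aa-≢₂ (λ e → ℕP.<⇒≢ (s≤s (ℕP.m≤n⇒m≤1+n (ℕP.m≤n+m a (double t)))) (≡-sym e))))
  (subst (λ z → occ (A j , A z) (forwardPairs j (suc (suc a)) k) ≡ 1) e (forwardPairs-hit j t (suc (suc a)) k lt))
  where
  e : double t + suc (suc a) ≡ double (suc t) + a
  e = trans (ℕP.+-suc (double t) (suc a)) (cong suc (ℕP.+-suc (double t) a))

forwardPairs-beyond : ∀ j y a k → double k + a ≤ suc y → occ (A j , A y) (forwardPairs j a k) ≡ 0
forwardPairs-beyond j y a zero h = refl
forwardPairs-beyond j y a (suc k) (s≤s h) = trans (occ-skip {A j , A y} {A j , A a} _ (aa-≢₂ (λ e → ℕP.<-irrefl (≡-sym e) ay)))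
  (forwardPairs-beyond j y (suc (suc a)) k (subst (_≤ suc y) (≡-sym e) (s≤s h)))
  where
  e : double k + suc (suc a) ≡ suc (suc (double k + a))
  e = trans (ℕP.+-suc (double k) (suc a)) (cong suc (ℕP.+-suc (double k) a))
  ay : a < y
  ay = ℕP.≤-trans (s≤s (ℕP.m≤n+m a (double k))) h

backwardPairs-other : ∀ {x y} j z → y ≢ j → occ (A x , A y) (backwardPairs j z) ≡ 0
backwardPairs-other j zero ne = refl
backwardPairs-other j (suc zero) ne = refl
backwardPairs-other {x} {y} j (suc (suc z)) ne = trans (occ-skip {A x , A y} {A z , A j} _ (aa-≢₂ ne)) (backwardPairs-other j z ne)

backwardPairs-small : ∀ x j z → z ≤ suc x → occ (A x , A j) (backwardPairs j z) ≡ 0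
backwardPairs-small x j zero h = refl
backwardPairs-small x j (suc zero) h = refl
backwardPairs-small x j (suc (suc z)) (s≤s h) = trans (occ-skip {A x , A j} {A z , A j} _ (aa-≢₁ (λ e → ℕP.<-irrefl (≡-sym e) h)))
  (backwardPairs-small x j z (ℕP.m≤n⇒m≤1+n (ℕP.<⇒≤ h)))

backwardPairs-hit : ∀ x j s → occ (A x , A j) (backwardPairs j (double s + suc (suc x))) ≡ 1
backwardPairs-hit x j zero = trans (occ-here (A x , A j) _) (cong suc (backwardPairs-small x j x (ℕP.n≤1+n x)))
backwardPairs-hit x j (suc s) = trans
  (occ-skip {A x , A j} {A (double s + suc (suc x)) , A j} _ (aa-≢₁ (λ e → ℕP.<⇒≢ (ℕP.≤-trans (ℕP.n<1+n x) (ℕP.≤-trans (ℕP.n≤1+n (suc x)) (ℕP.m≤n+m (suc (suc x)) (double s)))) e)))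
  (backwardPairs-hit x j s)

backwardPairs-parity : ∀ x j s → occ (A x , A j) (backwardPairs j (double s + suc x)) ≡ 0
backwardPairs-parity x j zero = backwardPairs-small x j (suc x) ℕP.≤-refl
backwardPairs-parity x j (suc s) = trans
  (occ-skip {A x , A j} {A (double s + suc x) , A j} _ (aa-≢₁ (λ e → ℕP.<⇒≢ (ℕP.≤-trans (ℕP.n<1+n x) (ℕP.m≤n+m (suc x) (double s))) e)))
  (backwardPairs-parity x j s)

aaCountF : ℕ → Code → ℕ → ℕ
aaCountF m' c j = occ c (ownedF m' j) + occ c ((A j , A (suc j)) ∷ [])

aaCountF-split : ∀ m' c j {a b d e} → occ c (topPair m' j) ≡ a → occ c (forwardPairs j (3 + j) (forwardCount m' j)) ≡ b →
  occ c (backwardPairs j j) ≡ d →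
     occ c ((A j , A (suc j)) ∷ []) ≡ e → aaCountF m' c j ≡ (a + (b + d)) + e
aaCountF-split m' c j h1 h2 h3 h4 = cong₂ _+_
  (trans (occ-++ c (topPair m' j) _) (cong₂ _+_ h1 (trans (occ-++ c (forwardPairs j (3 + j) (forwardCount m' j)) _) (cong₂ _+_ h2 h3)))) h4

link-miss : ∀ x y j → (A x , A y) ≢ (A j , A (suc j)) → occ (A x , A y) ((A j , A (suc j)) ∷ []) ≡ 0
link-miss x y j ne = occ-skip {A x , A y} {A j , A (suc j)} [] ne

-- The block of aⱼ (j < m') owns the pair aₓa_y (x < y ≤ m') when
--   y = x+1   and j = x (it is the link of aₓ),
--   y = m'    and j = x (the top pair),
--   y - x ≥ 2 even, y < m', and j = y (a backward pair),
--   y - x ≥ 3 odd,  y < m', and j = x (a forward pair);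
-- UniqueOwnerF records that exactly one block contains the pair, once.
UniqueOwnerF : ℕ → Code → Set
UniqueOwnerF m' c = Σ ℕ λ ℓ → ℓ < m' × aaCountF m' c ℓ ≡ 1 × (∀ j → j < m' → j ≢ ℓ → aaCountF m' c j ≡ 0)

aaCountF-other : ∀ m' x y j → j ≢ x → j ≢ y → aaCountF m' (A x , A y) j ≡ 0
aaCountF-other m' x y j jx jy =
  aaCountF-split m' (A x , A y) j (topPair-miss m' j (aa-≢₁ (λ e → jx (≡-sym e))))
    (forwardPairs-other j (3 + j) (forwardCount m' j) (λ e → jx (≡-sym e)))
    (backwardPairs-other j j (λ e → jy (≡-sym e))) (link-miss x y j (aa-≢₁ (λ e → jx (≡-sym e))))

ownerF-link : ∀ m' x → suc x ≤ m' → UniqueOwnerF m' (A x , A (suc x))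
ownerF-link m' x ym = x , ym , own , others
  where
  own : aaCountF m' (A x , A (suc x)) x ≡ 1
  own = aaCountF-split m' (A x , A (suc x)) x (topPair-link m' x)
    (forwardPairs-below x (3 + x) (forwardCount m' x) (ℕP.m<n⇒m<1+n (ℕP.n<1+n (suc x))))
    (backwardPairs-other x x (λ e → ℕP.<-irrefl (≡-sym e) (ℕP.n<1+n x))) (occ-here (A x , A (suc x)) [])
  others : ∀ j → j < m' → j ≢ x → aaCountF m' (A x , A (suc x)) j ≡ 0
  others j jm jx with j ℕ.≟ suc x
  ... | no jy = aaCountF-other m' x (suc x) j jx jy
  ... | yes refl = aaCountF-split m' (A x , A (suc x)) (suc x) (topPair-miss m' (suc x) (aa-≢₁ (λ e → jx (≡-sym e))))
          (forwardPairs-other (suc x) (3 + suc x) (forwardCount m' (suc x)) (λ e → jx (≡-sym e)))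
          (backwardPairs-small x (suc x) (suc x) ℕP.≤-refl) (link-miss x (suc x) (suc x) (aa-≢₁ (λ e → jx (≡-sym e))))

ownerF-top : ∀ m' x → suc (suc x) ≤ m' → UniqueOwnerF m' (A x , A m')
ownerF-top m' x x2 = x , xm , own , λ j jm jx → aaCountF-other m' x m' j jx (ℕP.<⇒≢ jm)
  where
  xm : x < m'
  xm = ℕP.<-trans (ℕP.n<1+n x) x2
  forward-end : double (forwardCount m' x) + (3 + x) ≤ suc m'
  forward-end = ℕP.≤-trans (ℕP.+-monoˡ-≤ (3 + x) (double-half (suc m' ∸ (3 + x)))) (ℕP.≤-reflexive (ℕP.m∸n+n≡m (s≤s x2)))
  own : aaCountF m' (A x , A m') x ≡ 1
  own = aaCountF-split m' (A x , A m') x (topPair-hit m' x x2) (forwardPairs-beyond x m' (3 + x) (forwardCount m' x) forward-end)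
    (backwardPairs-other x x (λ e → ℕP.<-irrefl (≡-sym e) xm)) (link-miss x m' x (aa-≢₂ (λ e → 2+≤⇒1+≢ x2 (≡-sym e))))

ownerF-backward : ∀ m' x s → double s + suc (suc x) < m' → UniqueOwnerF m' (A x , A (double s + suc (suc x)))
ownerF-backward m' x s ym = y , ym , own , others
  where
  y = double s + suc (suc x)
  xy : x < y
  xy = ℕP.≤-trans (ℕP.n≤1+n (suc x)) (ℕP.m≤n+m (suc (suc x)) (double s))
  own : aaCountF m' (A x , A y) y ≡ 1
  own = aaCountF-split m' (A x , A y) y (topPair-miss m' y (aa-≢₁ (ℕP.<⇒≢ xy)))
    (forwardPairs-other y (3 + y) (forwardCount m' y) (ℕP.<⇒≢ xy)) (backwardPairs-hit x y s) (link-miss x y y (aa-≢₁ (ℕP.<⇒≢ xy)))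
  others : ∀ j → j < m' → j ≢ y → aaCountF m' (A x , A y) j ≡ 0
  others j jm jy with j ℕ.≟ x
  ... | no jx = aaCountF-other m' x y j jx jy
  ... | yes refl = aaCountF-split m' (A x , A y) x (topPair-miss m' x (aa-≢₂ (ℕP.<⇒≢ ym)))
          (forwardPairs-parity x s (suc (suc x)) (forwardCount m' x))
          (backwardPairs-other x x (λ e → ℕP.<⇒≢ xy (≡-sym e)))
          (link-miss x y x (aa-≢₂ (λ e → 2+≤⇒1+≢ (ℕP.m≤n+m (suc (suc x)) (double s)) (≡-sym e))))

ownerF-forward : ∀ m' x s → suc (double s) + suc (suc x) < m' → UniqueOwnerF m' (A x , A (suc (double s) + suc (suc x)))
ownerF-forward m' x s ym = x , ℕP.<-trans xy ym , own , others
  where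
  y = suc (double s) + suc (suc x)
  xy : x < y
  xy = s≤s (ℕP.≤-trans (ℕP.n≤1+n x) (ℕP.≤-trans (ℕP.n≤1+n (suc x)) (ℕP.m≤n+m (suc (suc x)) (double s))))
  y-forward : double s + (3 + x) ≡ y
  y-forward = ℕP.+-suc (double s) (suc (suc x))
  s-in-range : s < forwardCount m' x
  s-in-range = half-lt s _ (ℕP.m+n≤o⇒m≤o∸n (double s + 2) (ℕP.≤-trans (ℕP.≤-reflexive arith) (s≤s ym)))
    where
    arith : double s + 2 + (3 + x) ≡ suc (suc y)
    arith = trans (ℕP.+-assoc (double s) 2 (3 + x))
      (trans (ℕP.+-suc (double s) (suc (3 + x))) (cong suc (trans (ℕP.+-suc (double s) (3 + x)) (cong suc y-forward))))
  own : aaCountF m' (A x , A y) x ≡ 1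
  own = aaCountF-split m' (A x , A y) x (topPair-miss m' x (aa-≢₂ (ℕP.<⇒≢ ym)))
    (subst (λ z → occ (A x , A z) (forwardPairs x (3 + x) (forwardCount m' x)) ≡ 1) y-forward
      (forwardPairs-hit x s (3 + x) (forwardCount m' x) s-in-range))
    (backwardPairs-other x x (λ e → ℕP.<⇒≢ xy (≡-sym e)))
    (link-miss x y x (aa-≢₂ (λ e → 2+≤⇒1+≢ (ℕP.m≤n+m (suc (suc x)) (suc (double s))) (≡-sym e))))
  others : ∀ j → j < m' → j ≢ x → aaCountF m' (A x , A y) j ≡ 0
  others j jm jx with j ℕ.≟ y
  ... | no jy = aaCountF-other m' x y j jx jy
  ... | yes refl = aaCountF-split m' (A x , A y) y (topPair-miss m' y (aa-≢₁ (λ e → jx (≡-sym e))))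
          (forwardPairs-other y (3 + y) (forwardCount m' y) (λ e → jx (≡-sym e)))
          (subst (λ z → occ (A x , A y) (backwardPairs y z) ≡ 0) (cong suc (≡-sym (ℕP.+-suc (double s) (suc x))))
            (backwardPairs-parity x y (suc s)))
          (link-miss x y y (aa-≢₁ (λ e → jx (≡-sym e))))

ownerF : ∀ m' x y → x < y → y ≤ m' → UniqueOwnerF m' (A x , A y)
ownerF m' x y xy ym with y ℕ.≟ suc x
... | yes refl = ownerF-link m' x ym
... | no y≢1+x with y ℕ.≟ m' | split≤ (suc (suc x)) y (ℕP.≤∧≢⇒< xy (λ e → y≢1+x (≡-sym e)))
...   | yes refl | _ = ownerF-top m' x (ℕP.≤∧≢⇒< xy (λ e → y≢1+x (≡-sym e)))
...   | no y≢m' | d , refl with parity d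
...     | even s = ownerF-backward m' x s (ℕP.≤∧≢⇒< ym y≢m')
...     | odd s = ownerF-forward m' x s (ℕP.≤∧≢⇒< ym y≢m')

-- For M₂ the diagonal aⱼaⱼ is owned by block j, and a_{m'}a_{m'} by the last piece.
aaCountM : ℕ → Code → ℕ → ℕ
aaCountM m' c j = occ c (ownedM m' j) + occ c ((A j , A (suc j)) ∷ [])

aaCountM-aaCountF : ∀ m' c j → aaCountM m' c j ≡ aaCountF m' c j + occ c ((A j , A j) ∷ [])
aaCountM-aaCountF m' c j = trans (cong (_+ occ c ((A j , A (suc j)) ∷ [])) (occ-++ c (ownedF m' j) _))
  (trans (ℕP.+-assoc (occ c (ownedF m' j)) _ _) (trans (cong (occ c (ownedF m' j) +_) (ℕP.+-comm (occ c ((A j , A j) ∷ [])) _))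
   (≡-sym (ℕP.+-assoc (occ c (ownedF m' j)) _ _))))

UniqueOwnerM : ℕ → Code → Set
UniqueOwnerM m' c = Σ ℕ λ ℓ → ℓ < m' × aaCountM m' c ℓ ≡ 1 × (∀ j → j < m' → j ≢ ℓ → aaCountM m' c j ≡ 0)

ownerM-offdiagonal : ∀ m' x y → x < y → y ≤ m' → UniqueOwnerM m' (A x , A y)
ownerM-offdiagonal m' x y xy ym with ownerF m' x y xy ym
... | ℓ , ℓm , own , others =
  ℓ , ℓm , trans (aaCountM-aaCountF m' _ ℓ) (cong₂ _+_ own (not-diagonal ℓ)) ,
  λ j jm jℓ → trans (aaCountM-aaCountF m' _ j) (cong₂ _+_ (others j jm jℓ) (not-diagonal j))
  where
  not-diagonal : ∀ j → occ (A x , A y) ((A j , A j) ∷ []) ≡ 0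
  not-diagonal j = occ-skip {A x , A y} {A j , A j} [] (λ e → ℕP.<-irrefl (trans (A-inj (cong proj₁ e)) (≡-sym (A-inj (cong proj₂ e)))) xy)

aaCountF-diagonal : ∀ m' x j → j < m' → aaCountF m' (A x , A x) j ≡ 0
aaCountF-diagonal m' x j jm with j ℕ.≟ x
... | no jx = aaCountF-other m' x x j jx jx
... | yes refl = aaCountF-split m' (A x , A x) x (topPair-miss m' x (aa-≢₂ (λ e → ℕP.<-irrefl e jm)))
                   (forwardPairs-below x (3 + x) (forwardCount m' x) (ℕP.m≤n⇒m≤1+n (ℕP.m≤n⇒m≤1+n (ℕP.n<1+n x))))
                   (backwardPairs-small x x x (ℕP.n≤1+n x)) (link-miss x x x (aa-≢₂ (λ e → ℕP.<-irrefl e (ℕP.n<1+n x))))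

ownerM-diagonal : ∀ m' x → x < m' → UniqueOwnerM m' (A x , A x)
ownerM-diagonal m' x xm = x , xm , trans (aaCountM-aaCountF m' _ x) (cong₂ _+_ (aaCountF-diagonal m' x x xm) (occ-here (A x , A x) [])) ,
  λ j jm jx → trans (aaCountM-aaCountF m' _ j)
    (cong₂ _+_ (aaCountF-diagonal m' x j jm) (occ-skip {A x , A x} {A j , A j} [] (aa-≢₁ (λ e → jx (≡-sym e)))))

aaCountM-top : ∀ m' j → j < m' → aaCountM m' (A m' , A m') j ≡ 0
aaCountM-top m' j jm = trans (aaCountM-aaCountF m' _ j)
  (cong₂ _+_ (aaCountF-diagonal m' m' j jm) (occ-skip {A m' , A m'} {A j , A j} [] (aa-≢₁ (λ e → ℕP.<-irrefl (≡-sym e) jm))))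

bb-≢₁ : ∀ {x y j z : ℕ} → x ≢ j → ¬ (_≡_ {A = Code} (B x , B y) (B j , B z))
bb-≢₁ ne e = ne (B-inj (cong proj₁ e))
bb-≢₂ : ∀ {x y j z : ℕ} → y ≢ z → ¬ (_≡_ {A = Code} (B x , B y) (B j , B z))
bb-≢₂ ne e = ne (B-inj (cong proj₂ e))

row-other : ∀ {x y} k f → x ≢ k → occ (B x , B y) (row k f) ≡ 0
row-other k zero ne = refl
row-other {x} {y} k (suc f) ne = trans (occ-skip {B x , B y} {B k , B (suc f + k)} _ (bb-≢₁ ne)) (row-other k f ne)

row-beyond : ∀ {y} k f → f + k < y → occ (B k , B y) (row k f) ≡ 0
row-beyond k zero h = refl
row-beyond {y} k (suc f) h = trans (occ-skip {B k , B y} {B k , B (suc f + k)} _ (bb-≢₂ (λ e → ℕP.<-irrefl (≡-sym e) h)))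
  (row-beyond k f (ℕP.<-trans (ℕP.n<1+n _) h))

row-hit : ∀ {y} k f → k < y → y ≤ f + k → occ (B k , B y) (row k f) ≡ 1
row-hit {y} k zero h1 h2 = ⊥-elim (ℕP.<-irrefl refl (ℕP.<-≤-trans h1 h2))
row-hit {y} k (suc f) h1 h2 with y ℕ.≟ suc f + k
... | yes refl = trans (occ-here _ (row k f)) (cong suc (row-beyond k f (ℕP.n<1+n _)))
... | no ne = trans (occ-skip {B k , B y} {B k , B (suc f + k)} _ (bb-≢₂ ne)) (row-hit k f h1 (ℕP.≤-pred (ℕP.≤∧≢⇒< h2 ne)))

rowGaps-below : ∀ {x y} k f → x < k → occ (B x , B y) (concat (rowGaps k f)) ≡ 0
rowGaps-below k zero h = refl
rowGaps-below {x} {y} k (suc f) h = trans (occ-++ (B x , B y) (row k (suc f)) _)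
  (cong₂ _+_ (row-other k (suc f) (ℕP.<⇒≢ h)) (rowGaps-below (suc k) f (ℕP.m<n⇒m<1+n h)))

rowGaps-hit : ∀ {x y} k f → k ≤ x → x < y → y ≤ f + k → occ (B x , B y) (concat (rowGaps k f)) ≡ 1
rowGaps-hit k zero h1 h2 h3 = ⊥-elim (ℕP.<-irrefl refl (ℕP.≤-<-trans h1 (ℕP.<-≤-trans h2 h3)))
rowGaps-hit {x} {y} k (suc f) h1 h2 h3 = aux (x ℕ.≟ k)
  where
  aux : Dec (x ≡ k) → occ (B x , B y) (concat (rowGaps k (suc f))) ≡ 1
  aux (yes e) = trans (occ-++ (B x , B y) (row k (suc f)) _) (cong₂ _+_
      (subst (λ z → occ (B z , B y) (row k (suc f)) ≡ 1) (≡-sym e) (row-hit k (suc f) (subst (_< y) e h2) h3))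
      (rowGaps-below (suc k) f (subst (_< suc k) (≡-sym e) (ℕP.n<1+n k))))
  aux (no ne) = trans (occ-++ (B x , B y) (row k (suc f)) _) (cong₂ _+_ (row-other k (suc f) ne)
       (rowGaps-hit (suc k) f (ℕP.≤∧≢⇒< h1 (λ e → ne (≡-sym e))) h2 (subst (y ≤_) (≡-sym (ℕP.+-suc f k)) h3)))

bbCount-lastF : ∀ p x y → x < y → y ≤ suc p → occ (B x , B y) (concat (lastGapsF p)) + occ (B x , B y) (closingF p) ≡ 1
bbCount-lastF p zero y h1 h2 = cong₂ _+_ (rowGaps-below 1 p (s≤s z≤n)) (row-hit 0 (suc p) h1 (subst (y ≤_) (≡-sym (ℕP.+-identityʳ (suc p))) h2))
bbCount-lastF p (suc x) y h1 h2 = cong₂ _+_ (rowGaps-hit 1 p (s≤s z≤n) h1 (subst (y ≤_) (ℕP.+-comm 1 p) h2))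
  (row-other {suc x} {y} 0 (suc p) (λ ()))

data RowFrom (k : ℕ) : Code → Set where
  rowFrom : ∀ {a b} → k ≤ a → RowFrom k (B a , B b)

not-rowFrom : ∀ {k a b} → a < k → ¬ RowFrom k (B a , B b)
not-rowFrom lt (rowFrom q) = ℕP.<-irrefl refl (ℕP.<-≤-trans lt q)

squares-from : ∀ k f → All (RowFrom k) (concat (squareGaps k f))
squares-from k zero = []
squares-from k (suc zero) = rowFrom ℕP.≤-refl ∷ rowFrom ℕP.≤-refl ∷ rowFrom (ℕP.n≤1+n k) ∷ []
squares-from k (suc (suc f)) = rowFrom ℕP.≤-refl ∷ rowFrom ℕP.≤-refl ∷ rowFrom (ℕP.n≤1+n k) ∷
  All.map (λ { (rowFrom h) → rowFrom (ℕP.≤-trans (ℕP.n≤1+n k) (ℕP.≤-trans (ℕP.n≤1+n (suc k)) h)) }) (squares-from (suc (suc k)) f)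

data SquareShape : Code → Set where
  sq-diagonal : ∀ a → SquareShape (B a , B a)
  sq-step : ∀ i → SquareShape (B (suc (double i)) , B (suc (suc (double i))))

squares-shape : ∀ i f → All SquareShape (concat (squareGaps (suc (double i)) f))
squares-shape i zero = []
squares-shape i (suc zero) = sq-diagonal _ ∷ sq-step i ∷ sq-diagonal _ ∷ []
squares-shape i (suc (suc f)) = sq-diagonal _ ∷ sq-step i ∷ sq-diagonal _ ∷ squares-shape (suc i) f

square-beyond : ∀ k {a b} → suc (suc k) ≤ a → occ (B a , B b) (square k) ≡ 0
square-beyond k {a} {b} le =
  trans (occ-skip {B a , B b} {B k , B k} _ (bb-≢₁ (λ e → 2+≤⇒≢ le (≡-sym e))))
    (trans (occ-skip {B a , B b} {B k , B (suc k)} _ (bb-≢₁ (λ e → 2+≤⇒≢ le (≡-sym e))))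
      (occ-skip {B a , B b} {B (suc k) , B (suc k)} [] (bb-≢₁ (λ e → 2+≤⇒1+≢ le (≡-sym e)))))

module SquareHit (h : ℕ → Code)
  (in-square : ∀ k → occ (h k) (square k) ≡ 1)
  (not-in-lower : ∀ k k₁ → suc (suc k) ≤ k₁ → occ (h k₁) (square k) ≡ 0)
  (below-row : ∀ k k' → suc (suc k) ≤ k' → ¬ RowFrom k' (h k)) where

  square-hit : ∀ t k f → suc (double t) ≤ f → occ (h (double t + k)) (concat (squareGaps k f)) ≡ 1
  square-hit zero k (suc zero) le = trans (occ-++ (h k) (square k) []) (cong (_+ 0) (in-square k))
  square-hit zero k (suc (suc f)) le = trans (occ-++ (h k) (square k) _) (cong₂ _+_ (in-square k)
     (occ-excluded (RowFrom (suc (suc k))) _ (squares-from (suc (suc k)) f) (below-row k (suc (suc k)) ℕP.≤-refl)))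
  square-hit (suc t) k (suc (suc f)) (s≤s (s≤s le)) = trans (occ-++ (h (double (suc t) + k)) (square k) _)
     (cong₂ _+_ (not-in-lower k _ (s≤s (s≤s (ℕP.m≤n+m k (double t)))))
       (subst (λ z → occ (h z) (concat (squareGaps (suc (suc k)) f)) ≡ 1) e (square-hit t (suc (suc k)) f le)))
    where
    e : double t + suc (suc k) ≡ double (suc t) + k
    e = trans (ℕP.+-suc (double t) (suc k)) (cong suc (ℕP.+-suc (double t) k))

module SquareDiag = SquareHit (λ k → B k , B k)
  (λ k → trans (occ-here (B k , B k) _) (cong suc (trans (occ-skip {B k , B k} {B k , B (suc k)} _ (bb-≢₂ (λ e → ℕP.<-irrefl e (ℕP.n<1+n k))))
           (occ-skip {B k , B k} {B (suc k) , B (suc k)} [] (bb-≢₁ (λ e → ℕP.<-irrefl e (ℕP.n<1+n k)))))))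
  (λ k k₁ le → square-beyond k le)
  (λ k k' le → not-rowFrom (ℕP.<-trans (ℕP.n<1+n k) le))

module SquareStep = SquareHit (λ k → B k , B (suc k))
  (λ k → trans (occ-skip {B k , B (suc k)} {B k , B k} _ (bb-≢₂ (λ e → ℕP.<-irrefl (≡-sym e) (ℕP.n<1+n k))))
           (trans (occ-here (B k , B (suc k)) _)
             (cong suc (occ-skip {B k , B (suc k)} {B (suc k) , B (suc k)} [] (bb-≢₁ (λ e → ℕP.<-irrefl e (ℕP.n<1+n k)))))))
  (λ k k₁ le → square-beyond k le)
  (λ k k' le → not-rowFrom (ℕP.<-trans (ℕP.n<1+n k) le))

module SquareNext = SquareHit (λ k → B (suc k) , B (suc k))
  (λ k → trans (occ-skip {B (suc k) , B (suc k)} {B k , B k} _ (bb-≢₁ (λ e → ℕP.<-irrefl (≡-sym e) (ℕP.n<1+n k))))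
           (trans (occ-skip {B (suc k) , B (suc k)} {B k , B (suc k)} _ (bb-≢₁ (λ e → ℕP.<-irrefl (≡-sym e) (ℕP.n<1+n k))))
             (occ-here (B (suc k) , B (suc k)) [])))
  (λ k k₁ le → square-beyond k (ℕP.≤-trans le (ℕP.n≤1+n k₁)))
  (λ k k' le → not-rowFrom le)

squares-top : ∀ k t → occ (B (double t + k) , B (double t + k)) (concat (squareGaps k (double t))) ≡ 0
squares-top k zero = refl
squares-top k (suc t) = trans (occ-++ (B (double (suc t) + k) , B (double (suc t) + k)) (square k) _)
  (cong₂ _+_ (square-beyond k (s≤s (s≤s (ℕP.m≤n+m k (double t)))))
    (subst (λ z → occ (B z , B z) (concat (squareGaps (suc (suc k)) (double t))) ≡ 0) e (squares-top (suc (suc k)) t)))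
  where
  e : double t + suc (suc k) ≡ double (suc t) + k
  e = trans (ℕP.+-suc (double t) (suc k)) (cong suc (ℕP.+-suc (double t) k))

data ColumnsUpTo (d : ℕ) : Code → Set where
  columnUpTo : ∀ {a b} → b ≤ d → ColumnsUpTo d (B a , B b)

data InColumn (L : ℕ) : Code → Set where
  inColumn : ∀ {a} → InColumn L (B a , B L)

colUp-column : ∀ L j f → All (InColumn L) (colUp L j f)
colUp-column L j zero = []
colUp-column L j (suc f) = inColumn ∷ colUp-column L (suc j) f

colDown-column : ∀ L j → All (InColumn L) (colDown L j)
colDown-column L zero = []
colDown-column L (suc j) = inColumn ∷ colDown-column L j

column-upTo : ∀ {L d xs} → L ≤ d → All (InColumn L) xs → All (ColumnsUpTo d) xs
column-upTo h = All.map (λ { inColumn → columnUpTo h })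

snake-columns : ∀ h → All (ColumnsUpTo (double h)) (snake h)
snake-columns zero = columnUpTo z≤n ∷ []
snake-columns (suc h) = columnUpTo ℕP.≤-refl ∷ ++⁺ (column-upTo ℕP.≤-refl (colUp-column _ 0 (double h)))
  (columnUpTo (ℕP.n≤1+n _) ∷ ++⁺ (column-upTo (ℕP.n≤1+n _) (colDown-column _ (double h)))
     (All.map (λ { (columnUpTo q) → columnUpTo (ℕP.≤-trans q (ℕP.≤-trans (ℕP.n≤1+n _) (ℕP.n≤1+n _))) }) (snake-columns h)))

snake-above : ∀ {x y} h → double h < y → occ (B x , B y) (snake h) ≡ 0
snake-above {x} {y} h lt = occ-excluded {B x , B y} (ColumnsUpTo (double h)) _ (snake-columns h)
  (λ { (columnUpTo q) → ℕP.<-irrefl refl (ℕP.<-≤-trans lt q) })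

colUp-other : ∀ {x y} L j f → y ≢ L → occ (B x , B y) (colUp L j f) ≡ 0
colUp-other {x} {y} L j f ne = occ-excluded {B x , B y} (InColumn L) _ (colUp-column L j f) (λ { inColumn → ne refl })
colDown-other : ∀ {x y} L j → y ≢ L → occ (B x , B y) (colDown L j) ≡ 0
colDown-other {x} {y} L j ne = occ-excluded {B x , B y} (InColumn L) _ (colDown-column L j) (λ { inColumn → ne refl })

colUp-below : ∀ {x} L j f → x ≤ j → occ (B x , B L) (colUp L j f) ≡ 0
colUp-below L j zero h = refl
colUp-below {x} L j (suc f) h = trans (occ-skip {B x , B L} {B (suc j) , B L} _ (bb-≢₁ (λ e → ℕP.<-irrefl e (s≤s h))))
  (colUp-below L (suc j) f (ℕP.m≤n⇒m≤1+n h))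

colUp-beyond : ∀ {x} L j f → f + j < x → occ (B x , B L) (colUp L j f) ≡ 0
colUp-beyond L j zero h = refl
colUp-beyond {x} L j (suc f) h = trans
  (occ-skip {B x , B L} {B (suc j) , B L} _ (bb-≢₁ (λ e → ℕP.<-irrefl (≡-sym e) (ℕP.≤-<-trans (s≤s (ℕP.m≤n+m j f)) h))))
  (colUp-beyond L (suc j) f (subst (_< x) (≡-sym (ℕP.+-suc f j)) h))

colUp-hit : ∀ {x} L j f → j < x → x ≤ f + j → occ (B x , B L) (colUp L j f) ≡ 1
colUp-hit L j zero h1 h2 = ⊥-elim (ℕP.<-irrefl refl (ℕP.<-≤-trans h1 h2))
colUp-hit {x} L j (suc f) h1 h2 = aux (x ℕ.≟ suc j)
  where
  aux : Dec (x ≡ suc j) → occ (B x , B L) (colUp L j (suc f)) ≡ 1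
  aux (yes e) = subst (λ z → occ (B z , B L) (colUp L j (suc f)) ≡ 1) (≡-sym e)
     (trans (occ-here (B (suc j) , B L) _) (cong suc (colUp-below L (suc j) f ℕP.≤-refl)))
  aux (no ne) = trans (occ-skip {B x , B L} {B (suc j) , B L} _ (bb-≢₁ ne))
     (colUp-hit L (suc j) f (ℕP.≤∧≢⇒< h1 (λ e → ne (≡-sym e))) (subst (x ≤_) (≡-sym (ℕP.+-suc f j)) h2))

colDown-beyond : ∀ {x} L j → j ≤ x → occ (B x , B L) (colDown L j) ≡ 0
colDown-beyond L zero h = refl
colDown-beyond {x} L (suc j) h = trans (occ-skip {B x , B L} {B j , B L} _ (bb-≢₁ (λ e → ℕP.<-irrefl (≡-sym e) h)))
  (colDown-beyond L j (ℕP.≤-trans (ℕP.n≤1+n j) h))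

colDown-hit : ∀ {x} L j → x < j → occ (B x , B L) (colDown L j) ≡ 1
colDown-hit {x} L (suc j) h = aux (x ℕ.≟ j)
  where
  aux : Dec (x ≡ j) → occ (B x , B L) (colDown L (suc j)) ≡ 1
  aux (yes e) = subst (λ z → occ (B z , B L) (colDown L (suc j)) ≡ 1) (≡-sym e)
     (trans (occ-here (B j , B L) _) (cong suc (colDown-beyond L j ℕP.≤-refl)))
  aux (no ne) = trans (occ-skip {B x , B L} {B j , B L} _ (bb-≢₁ ne)) (colDown-hit L j (ℕP.≤∧≢⇒< (ℕP.≤-pred h) ne))

snake-split : ∀ c g → occ c (snake (suc g)) ≡ occ c ((B 0 , B (double (suc g))) ∷ []) + (occ c (colUp (double (suc g)) 0 (double g)) +
  (occ c ((B (double g) , B (suc (double g))) ∷ []) + (occ c (colDown (suc (double g)) (double g)) + occ c (snake g))))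
snake-split c g = trans (occ-cons c _ _) (cong (occ c ((B 0 , B (double (suc g))) ∷ []) +_)
  (trans (occ-++ c (colUp (double (suc g)) 0 (double g)) _) (cong (occ c (colUp (double (suc g)) 0 (double g)) +_)
    (trans (occ-cons c _ _)
      (cong (occ c ((B (double g) , B (suc (double g))) ∷ []) +_) (occ-++ c (colDown (suc (double g)) (double g)) (snake g)))))))

single-miss : ∀ {x y a b} → (x ≢ a ⊎ y ≢ b) → occ (B x , B y) ((B a , B b) ∷ []) ≡ 0
single-miss {x} {y} {a} {b} (inj₁ ne) = occ-skip {B x , B y} {B a , B b} [] (bb-≢₁ ne)
single-miss {x} {y} {a} {b} (inj₂ ne) = occ-skip {B x , B y} {B a , B b} [] (bb-≢₂ ne)

cong-+₅ : ∀ {a b c d e a' b' c' d' e' : ℕ} → a ≡ a' → b ≡ b' → c ≡ c' → d ≡ d' → e ≡ e' → a + (b + (c + (d + e))) ≡ a' + (b' + (c' + (d' + e')))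
cong-+₅ refl refl refl refl refl = refl

snake-evenCol-hit : ∀ {x} g → x ≤ double g → occ (B x , B (double (suc g))) (snake (suc g)) ≡ 1
snake-evenCol-hit {zero} g h = trans (snake-split (B 0 , B L) g) (cong-+₅ (occ-here (B 0 , B L) [])
  (colUp-below {0} L 0 (double g) z≤n)
    (single-miss {0} {L} {double g} {suc (double g)} (inj₂ (λ e → ℕP.<⇒≢ (ℕP.n<1+n _) (≡-sym e))))
    (colDown-other {0} {L} (suc (double g)) (double g) (λ e → ℕP.<⇒≢ (ℕP.n<1+n _) (≡-sym e)))
    (snake-above {0} {L} g (ℕP.≤-trans (ℕP.n<1+n _) (ℕP.n≤1+n _))))
  where L = double (suc g)
snake-evenCol-hit {suc x} g h = trans (snake-split (B (suc x) , B L) g) (cong-+₅ (single-miss {suc x} {L} {0} {L} (inj₁ (λ ())))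
  (colUp-hit {suc x} L 0 (double g) (s≤s z≤n) (subst (suc x ≤_) (≡-sym (ℕP.+-identityʳ (double g))) h))
    (single-miss {suc x} {L} {double g} {suc (double g)} (inj₂ (λ e → ℕP.<⇒≢ (ℕP.n<1+n _) (≡-sym e))))
      (colDown-other {suc x} {L} (suc (double g)) (double g) (λ e → ℕP.<⇒≢ (ℕP.n<1+n _) (≡-sym e)))
    (snake-above {suc x} {L} g (ℕP.≤-trans (ℕP.n<1+n _) (ℕP.n≤1+n _))))
  where L = double (suc g)

snake-evenCol-miss : ∀ {x} g → double g < x → occ (B x , B (double (suc g))) (snake (suc g)) ≡ 0
snake-evenCol-miss {x} g h = trans (snake-split (B x , B L) g)
  (cong-+₅ (single-miss {x} {L} {0} {L} (inj₁ (λ e → ℕP.<⇒≢ (ℕP.≤-<-trans z≤n h) (≡-sym e))))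
  (colUp-beyond {x} L 0 (double g) (subst (_< x) (≡-sym (ℕP.+-identityʳ (double g))) h))
    (single-miss {x} {L} {double g} {suc (double g)} (inj₂ (λ e → ℕP.<⇒≢ (ℕP.n<1+n _) (≡-sym e))))
      (colDown-other {x} {L} (suc (double g)) (double g) (λ e → ℕP.<⇒≢ (ℕP.n<1+n _) (≡-sym e)))
    (snake-above {x} {L} g (ℕP.≤-trans (ℕP.n<1+n _) (ℕP.n≤1+n _))))
  where L = double (suc g)

snake-oddCol-hit : ∀ {x} g → x ≤ double g → occ (B x , B (suc (double g))) (snake (suc g)) ≡ 1
snake-oddCol-hit {x} g h with x ℕ.≟ double g
... | yes refl = trans (snake-split (B x , B L') g) (cong-+₅ (single-miss {x} {L'} {0} {double (suc g)} (inj₂ (λ e → ℕP.<⇒≢ (ℕP.n<1+n _) e)))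
      (colUp-other {x} {L'} (double (suc g)) 0 (double g) (λ e → ℕP.<⇒≢ (ℕP.n<1+n _) e)) (occ-here (B (double g) , B L') [])
      (colDown-beyond {x} L' (double g) ℕP.≤-refl) (snake-above {x} {L'} g (ℕP.n<1+n _)))
  where L' = suc (double g)
... | no ne = trans (snake-split (B x , B L') g) (cong-+₅ (single-miss {x} {L'} {0} {double (suc g)} (inj₂ (λ e → ℕP.<⇒≢ (ℕP.n<1+n _) e)))
      (colUp-other {x} {L'} (double (suc g)) 0 (double g) (λ e → ℕP.<⇒≢ (ℕP.n<1+n _) e)) (single-miss {x} {L'} {double g} {L'} (inj₁ ne))
      (colDown-hit {x} L' (double g) (ℕP.≤∧≢⇒< h ne)) (snake-above {x} {L'} g (ℕP.n<1+n _)))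
  where L' = suc (double g)

snake-oddCol-miss : ∀ {x} g → double g < x → occ (B x , B (suc (double g))) (snake (suc g)) ≡ 0
snake-oddCol-miss {x} g h = trans (snake-split (B x , B L') g)
  (cong-+₅ (single-miss {x} {L'} {0} {double (suc g)} (inj₂ (λ e → ℕP.<⇒≢ (ℕP.n<1+n _) e)))
  (colUp-other {x} {L'} (double (suc g)) 0 (double g) (λ e → ℕP.<⇒≢ (ℕP.n<1+n _) e))
    (single-miss {x} {L'} {double g} {L'} (inj₁ (λ e → ℕP.<⇒≢ h (≡-sym e)))) (colDown-beyond {x} L' (double g) (ℕP.<⇒≤ h))
      (snake-above {x} {L'} g (ℕP.n<1+n _)))
  where L' = suc (double g)

snake-rec : ∀ {x y} h → y ≤ double h → occ (B x , B y) (snake (suc h)) ≡ occ (B x , B y) (snake h)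
snake-rec {x} {y} h le = trans (snake-split (B x , B y) h)
  (cong-+₅ (single-miss {x} {y} {0} {double (suc h)} (inj₂ (λ e → ℕP.<⇒≢ (ℕP.≤-<-trans le (ℕP.≤-trans (ℕP.n<1+n _) (ℕP.n≤1+n _))) e)))
  (colUp-other {x} {y} (double (suc h)) 0 (double h) (λ e → ℕP.<⇒≢ (ℕP.≤-<-trans le (ℕP.≤-trans (ℕP.n<1+n _) (ℕP.n≤1+n _))) e))
    (single-miss {x} {y} {double h} {suc (double h)} (inj₂ (λ e → ℕP.<⇒≢ (ℕP.≤-<-trans le (ℕP.n<1+n _)) e)))
    (colDown-other {x} {y} (suc (double h)) (double h) (λ e → ℕP.<⇒≢ (ℕP.≤-<-trans le (ℕP.n<1+n _)) e)) refl)

snake-origin : ∀ h → occ (B 0 , B 0) (snake h) ≡ 1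
snake-origin zero = occ-here (B 0 , B 0) []
snake-origin (suc h) = trans (snake-rec {0} {0} h z≤n) (snake-origin h)

snake-peel : ∀ {x y} d g → y ≤ double (suc g) → occ (B x , B y) (snake (suc (d + g))) ≡ occ (B x , B y) (snake (suc g))
snake-peel zero g le = refl
snake-peel {x} {y} (suc d) g le = trans (snake-rec {x} {y} (suc (d + g)) (ℕP.≤-trans le (double-mono (s≤s (ℕP.m≤n+m g d)))))
  (snake-peel {x} {y} d g le)

snake-from : ∀ {x y} g h → suc g ≤ h → y ≤ double (suc g) → occ (B x , B y) (snake h) ≡ occ (B x , B y) (snake (suc g))
snake-from {x} {y} g (suc h) (s≤s le) ley with split≤ g h le
... | d , refl = snake-peel {x} {y} d g ley

closingM-odd-prefix : ∀ {x y} h → y ≢ suc (double h) →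
  occ (B x , B y) ((B (suc (double h)) , B (suc (double h))) ∷ colDown (suc (double h)) (suc (double h)) ++ snake h)
    ≡ occ (B x , B y) (snake h)
closingM-odd-prefix {x} {y} h ne = trans (occ-skip {B x , B y} {B (suc (double h)) , B (suc (double h))} _ (bb-≢₂ ne))
  (trans (occ-++ (B x , B y) (colDown (suc (double h)) (suc (double h))) (snake h))
    (cong (_+ occ (B x , B y) (snake h)) (colDown-other {x} {y} _ (suc (double h)) ne)))

closingM-origin : ∀ n' → 1 ≤ n' → occ (B 0 , B 0) (closingM n') ≡ 1
closingM-origin n' h with parity n'
closingM-origin .0 () | even zero
... | even (suc h') = snake-origin (suc h')
... | odd h' = trans (closingM-odd-prefix {0} {0} h' (λ ())) (snake-origin h')

closingM-even-low : ∀ n' x g → x ≤ double g → double (suc g) ≤ n' → occ (B x , B (double (suc g))) (closingM n') ≡ 1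
closingM-even-low n' x g hx hy with parity n'
closingM-even-low .0 x g hx () | even zero
... | even (suc h) = trans (snake-from {x} g (suc h) (double≤double⇒≤ (suc g) (suc h) hy) ℕP.≤-refl) (snake-evenCol-hit g hx)
... | odd h = trans (closingM-odd-prefix {x} h (double≢odd (suc g) h))
                (trans (snake-from {x} g h (double≤1+double⇒≤ (suc g) h hy) ℕP.≤-refl) (snake-evenCol-hit g hx))

closingM-even-high : ∀ n' x g → double g < x → double (suc g) ≤ n' → occ (B x , B (double (suc g))) (closingM n') ≡ 0
closingM-even-high n' x g hx hy with parity n'
closingM-even-high .0 x g hx () | even zero
... | even (suc h) = trans (snake-from {x} g (suc h) (double≤double⇒≤ (suc g) (suc h) hy) ℕP.≤-refl) (snake-evenCol-miss g hx)
... | odd h = trans (closingM-odd-prefix {x} h (double≢odd (suc g) h))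
                (trans (snake-from {x} g h (double≤1+double⇒≤ (suc g) h hy) ℕP.≤-refl) (snake-evenCol-miss g hx))

closingM-odd-low : ∀ n' x g → x ≤ double g → suc (double g) ≤ n' → occ (B x , B (suc (double g))) (closingM n') ≡ 1
closingM-odd-low n' x g hx hy with parity n'
closingM-odd-low .0 x g hx () | even zero
... | even (suc h) = trans (snake-from {x} g (suc h) (s≤s (double≤1+double⇒≤ g h (ℕP.≤-pred hy))) (ℕP.n≤1+n _)) (snake-oddCol-hit g hx)
... | odd h with g ℕ.≟ h
...   | yes refl = trans (occ-skip {B x , B (suc (double g))} {B (suc (double g)) , B (suc (double g))} _ (bb-≢₁ (λ e → ℕP.<-irrefl e (s≤s hx))))
          (trans (occ-++ (B x , B (suc (double g))) (colDown (suc (double g)) (suc (double g))) (snake g))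
            (cong₂ _+_ (colDown-hit {x} _ (suc (double g)) (s≤s hx)) (snake-above {x} g (ℕP.n<1+n _))))
...   | no ne = trans (closingM-odd-prefix {x} h (λ e → ne (double-injective g h (ℕP.suc-injective e))))
          (trans (snake-from {x} g h (ℕP.≤∧≢⇒< (double≤double⇒≤ g h (ℕP.≤-pred hy)) ne) (ℕP.n≤1+n _)) (snake-oddCol-hit g hx))

closingM-odd-diagonal : ∀ n' g → suc (double g) < n' → occ (B (suc (double g)) , B (suc (double g))) (closingM n') ≡ 0
closingM-odd-diagonal n' g hy with parity n'
closingM-odd-diagonal .0 g () | even zero
... | even (suc h) = trans (snake-from {suc (double g)} g (suc h) (double≤double⇒≤ (suc g) (suc h) hy) (ℕP.n≤1+n _))
                       (snake-oddCol-miss g (ℕP.n<1+n _))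
... | odd h = trans (closingM-odd-prefix {suc (double g)} h (λ e → ℕP.<-irrefl e hy))
                (trans (snake-from {suc (double g)} g h (double≤1+double⇒≤ (suc g) h hy) (ℕP.n≤1+n _)) (snake-oddCol-miss g (ℕP.n<1+n _)))

closingM-odd-top : ∀ n' g → n' ≡ suc (double g) → occ (B n' , B n') (closingM n') ≡ 1
closingM-odd-top n' g e with parity n'
... | even h = ⊥-elim (double≢odd h g e)
... | odd h = trans (occ-here (B (suc (double h)) , B (suc (double h))) _)
  (cong suc (trans (occ-++ (B (suc (double h)) , B (suc (double h))) (colDown (suc (double h)) (suc (double h))) (snake h))
    (cong₂ _+_ (colDown-beyond {suc (double h)} _ (suc (double h)) ℕP.≤-refl) (snake-above {suc (double h)} h (ℕP.n<1+n _)))))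

squareShape-cases : ∀ {a b} → SquareShape (B a , B b) → (a ≡ b) ⊎ (Σ ℕ λ i → a ≡ suc (double i) × b ≡ suc a)
squareShape-cases (sq-diagonal _) = inj₁ refl
squareShape-cases (sq-step i) = inj₂ (i , refl , refl)

not-squareShape-odd : ∀ x g → x ≤ double g → ¬ SquareShape (B x , B (suc (double g)))
not-squareShape-odd x g h gu with squareShape-cases gu
... | inj₁ e = ℕP.<-irrefl e (s≤s h)
... | inj₂ (i , e1 , e2) = double≢odd g i (trans (ℕP.suc-injective e2) e1)

not-squareShape-even : ∀ x g → x ≤ double g → ¬ SquareShape (B x , B (double (suc g)))
not-squareShape-even x g h gu with squareShape-cases gu
... | inj₁ e = ℕP.<-irrefl e (ℕP.≤-trans (s≤s h) (ℕP.n≤1+n _))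
... | inj₂ (i , e1 , e2) = ℕP.<-irrefl (≡-sym (ℕP.suc-injective e2)) (s≤s h)

squaresAndClosing : ℕ → ℕ → ℕ → ℕ
squaresAndClosing p x y = occ (B x , B y) (concat (squareGaps 1 p)) + occ (B x , B y) (closingM (suc p))

-- A code bₓb_{2g} (x ≤ 2g ≤ p+1) is in the closing if x + 2 ≤ 2g or x = 2g = 0,
-- and in a square otherwise.
bbCount-even : ∀ p x g → x ≤ double g → double g ≤ suc p → squaresAndClosing p x (double g) ≡ 1
bbCount-even p .0 zero z≤n yp =
  cong₂ _+_ (occ-excluded {B 0 , B 0} (RowFrom 1) _ (squares-from 1 p) (λ { (rowFrom ()) })) (closingM-origin (suc p) (s≤s z≤n))
bbCount-even p x (suc g) xy yp with x ℕ.≤? double g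
... | yes le = cong₂ _+_ (occ-excluded {B x , B (double (suc g))} SquareShape _ (squares-shape 0 p) (not-squareShape-even x g le))
                         (closingM-even-low (suc p) x g le yp)
... | no nle with x ℕ.≟ suc (double g)
...   | yes refl = cong₂ _+_ (subst (λ z → occ (B z , B (suc z)) (concat (squareGaps 1 p)) ≡ 1) (ℕP.+-comm (double g) 1)
                               (SquareStep.square-hit g 1 p (ℕP.≤-pred yp)))
                             (closingM-even-high (suc p) (suc (double g)) g (ℕP.n<1+n _) yp)
...   | no ne = cong₂ _+_ (subst (λ z → occ (B z , B (double (suc g))) (concat (squareGaps 1 p)) ≡ 1) (≡-sym x≡2g+2) in-square)
                          (closingM-even-high (suc p) x g (ℕP.≰⇒> nle) yp)
  where
  x≡2g+2 : x ≡ double (suc g)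
  x≡2g+2 = ℕP.≤-antisym xy (ℕP.≤∧≢⇒< (ℕP.≰⇒> nle) (λ e → ne (≡-sym e)))
  in-square : occ (B (double (suc g)) , B (double (suc g))) (concat (squareGaps 1 p)) ≡ 1
  in-square = subst (λ z → occ (B (suc z) , B (suc z)) (concat (squareGaps 1 p)) ≡ 1) (ℕP.+-comm (double g) 1)
                (SquareNext.square-hit g 1 p (ℕP.≤-pred yp))

-- A code bₓb_{2g+1} (x ≤ 2g+1 ≤ p+1) is in the closing if x ≤ 2g; the diagonal
-- is in a square, unless 2g+1 = p+1, where it starts the closing.
bbCount-odd : ∀ p x g → x ≤ suc (double g) → suc (double g) ≤ suc p → squaresAndClosing p x (suc (double g)) ≡ 1
bbCount-odd p x g xy yp with x ℕ.≤? double g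
... | yes le = cong₂ _+_ (occ-excluded {B x , B (suc (double g))} SquareShape _ (squares-shape 0 p) (not-squareShape-odd x g le))
                         (closingM-odd-low (suc p) x g le yp)
... | no nle with ℕP.≤-antisym xy (ℕP.≰⇒> nle)
...   | refl with suc (double g) ℕ.≟ suc p
...     | no ne = cong₂ _+_ (subst (λ z → occ (B z , B z) (concat (squareGaps 1 p)) ≡ 1) (ℕP.+-comm (double g) 1)
                              (SquareDiag.square-hit g 1 p (ℕP.≤-pred (ℕP.≤∧≢⇒< yp ne))))
                            (closingM-odd-diagonal (suc p) g (ℕP.≤∧≢⇒< yp ne))
...     | yes e = cong₂ _+_ not-in-squares
  (subst (λ z → occ (B z , B z) (closingM (suc p)) ≡ 1) (≡-sym e) (closingM-odd-top (suc p) g (≡-sym e)))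
  where
  not-in-squares : occ (B (suc (double g)) , B (suc (double g))) (concat (squareGaps 1 p)) ≡ 0
  not-in-squares rewrite ≡-sym (ℕP.suc-injective e) =
    subst (λ z → occ (B z , B z) (concat (squareGaps 1 (double g))) ≡ 0) (ℕP.+-comm (double g) 1) (squares-top 1 g)

bbCount-lastM : ∀ m' p x y → x ≤ y → y ≤ suc p → occ (B x , B y) (concat (lastGapsM m' p)) + occ (B x , B y) (closingM (suc p)) ≡ 1
bbCount-lastM m' p x y xy yp =
  trans (cong (_+ occ (B x , B y) (closingM (suc p))) (occ-skip {B x , B y} {A m' , A m'} (concat (squareGaps 1 p)) (λ ())))
        (by-parity (parity y) xy yp)
  where
  by-parity : ∀ {y} → Parity y → x ≤ y → y ≤ suc p → squaresAndClosing p x y ≡ 1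
  by-parity (even g) = bbCount-even p x g
  by-parity (odd g) = bbCount-odd p x g

data IsBB : Code → Set where
  isbb : ∀ {a b} → IsBB (B a , B b)

bb⇒nonAB : ∀ {c} → IsBB c → NotAB c
bb⇒nonAB isbb = nBB

all-bb⇒nonAB : ∀ {L} → All IsBB L → All NotAB L
all-bb⇒nonAB = All.map bb⇒nonAB

row-bb : ∀ k f → All IsBB (row k f)
row-bb k zero = []
row-bb k (suc f) = isbb ∷ row-bb k f

rowGaps-bb : ∀ k f → All IsBB (concat (rowGaps k f))
rowGaps-bb k zero = []
rowGaps-bb k (suc f) = ++⁺ (row-bb k (suc f)) (rowGaps-bb (suc k) f)

squareGaps-bb : ∀ k f → All IsBB (concat (squareGaps k f))
squareGaps-bb k zero = []
squareGaps-bb k (suc zero) = isbb ∷ isbb ∷ isbb ∷ []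
squareGaps-bb k (suc (suc f)) = isbb ∷ isbb ∷ isbb ∷ squareGaps-bb (suc (suc k)) f

colDown-bb : ∀ L j → All IsBB (colDown L j)
colDown-bb L j = All.map (λ { inColumn → isbb }) (colDown-column L j)

snake-bb : ∀ h → All IsBB (snake h)
snake-bb h = All.map (λ { (columnUpTo _) → isbb }) (snake-columns h)

closingM-bb : ∀ n' → All IsBB (closingM n')
closingM-bb n' with parity n'
... | even zero = []
... | even (suc h) = snake-bb (suc h)
... | odd h = isbb ∷ ++⁺ (colDown-bb _ (suc (double h))) (snake-bb h)

closingF-bb : ∀ p → All IsBB (closingF p)
closingF-bb p = row-bb 0 (suc p)

aa-notBB : ∀ {x y} → ¬ IsBB (A x , A y)
aa-notBB ()

module CountingF (m' p : ℕ) where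
  open Route m' (suc p) (ownedF m') (ownedF-bounce m') (lastPieceF m' p)

  lastPiece-split : ∀ c → occ c (lastPieceF m' p) ≡ occ c (block m' 0 (lastGapsF p)) + occ c (closingF p)
  lastPiece-split c = occ-++ c (block m' 0 (lastGapsF p)) (closingF p)

  lastGaps-nonAB : All NotAB (concat (lastGapsF p))
  lastGaps-nonAB = all-bb⇒nonAB (rowGaps-bb 1 p)

  closing-nonAB : All NotAB (closingF p)
  closing-nonAB = all-bb⇒nonAB (closingF-bb p)

  lastPiece-ab-own : ∀ y → y ≤ suc p → occ (A m' , B y) (lastPieceF m' p) ≡ 1
  lastPiece-ab-own y yp = trans (lastPiece-split (A m' , B y))
    (cong₂ _+_ (block-ab-hit {m'} {y} 0 (lastGapsF p) z≤n (subst (y ≤_) (≡-sym (trans (lastGapsF-end p) (ℕP.+-identityʳ (suc p)))) yp) lastGaps-nonAB)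
               (occ-notAB {m'} {y} (closingF p) closing-nonAB))

  lastPiece-ab-other : ∀ x y → x ≢ m' → occ (A x , B y) (lastPieceF m' p) ≡ 0
  lastPiece-ab-other x y ne = trans (lastPiece-split (A x , B y))
    (cong₂ _+_ (block-ab-other {x} {y} m' 0 (lastGapsF p) ne lastGaps-nonAB) (occ-notAB {x} {y} (closingF p) closing-nonAB))

  lastPiece-aa : ∀ x y → occ (A x , A y) (lastPieceF m' p) ≡ 0
  lastPiece-aa x y = trans (lastPiece-split (A x , A y))
    (cong₂ _+_ (trans (block-nonAB {A x , A y} m' 0 (lastGapsF p) nAA) (occ-excluded {A x , A y} IsBB _ (rowGaps-bb 1 p) aa-notBB))
               (occ-excluded {A x , A y} IsBB _ (closingF-bb p) aa-notBB))

  lastPiece-bb : ∀ x y → x < y → y ≤ suc p → occ (B x , B y) (lastPieceF m' p) ≡ 1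
  lastPiece-bb x y xy yp = trans (lastPiece-split (B x , B y))
    (trans (cong (_+ occ (B x , B y) (closingF p)) (block-nonAB {B x , B y} m' 0 (lastGapsF p) nBB)) (bbCount-lastF p x y xy yp))

  occurs-onceF : ∀ c → CanF m' (suc p) c → occ c route ≡ 1
  occurs-onceF (A x , B y) (cAB xm yq) =
    route-ab x y (ℕP.≤-pred xm) (ℕP.≤-pred yq) (λ { refl → lastPiece-ab-own y (ℕP.≤-pred yq) }) (lastPiece-ab-other x y)
  occurs-onceF (A x , A y) (cAA xy ym) with ownerF m' x y xy (ℕP.≤-pred ym)
  ... | ℓ , ℓm , own , others = route-block (A x , A y) ℓ ℓm (trans (blockCount-aa x y ℓ) own)
          (λ j jm jℓ → trans (blockCount-aa x y j) (others j jm jℓ)) (lastPiece-aa x y)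
  occurs-onceF (B x , B y) (cBB xy yq) = route-bb x y (lastPiece-bb x y xy (ℕP.≤-pred yq))

module CountingM (m' p : ℕ) where
  open Route m' (suc p) (ownedM m') (ownedM-bounce m') (lastPieceM m' p)

  lastPiece-split : ∀ c → occ c (lastPieceM m' p) ≡ occ c (block m' 0 (lastGapsM m' p)) + occ c (closingM (suc p))
  lastPiece-split c = occ-++ c (block m' 0 (lastGapsM m' p)) (closingM (suc p))

  lastGaps-nonAB : All NotAB (concat (lastGapsM m' p))
  lastGaps-nonAB = nAA ∷ all-bb⇒nonAB (squareGaps-bb 1 p)

  closing-nonAB : All NotAB (closingM (suc p))
  closing-nonAB = all-bb⇒nonAB (closingM-bb (suc p))

  lastPiece-ab-own : ∀ y → y ≤ suc p → occ (A m' , B y) (lastPieceM m' p) ≡ 1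
  lastPiece-ab-own y yp = trans (lastPiece-split (A m' , B y))
    (cong₂ _+_ (block-ab-hit {m'} {y} 0 (lastGapsM m' p) z≤n (subst (y ≤_) (≡-sym (lastGapsM-end m' p)) yp) lastGaps-nonAB)
               (occ-notAB {m'} {y} (closingM (suc p)) closing-nonAB))

  lastPiece-ab-other : ∀ x y → x ≢ m' → occ (A x , B y) (lastPieceM m' p) ≡ 0
  lastPiece-ab-other x y ne = trans (lastPiece-split (A x , B y))
    (cong₂ _+_ (block-ab-other {x} {y} m' 0 (lastGapsM m' p) ne lastGaps-nonAB) (occ-notAB {x} {y} (closingM (suc p)) closing-nonAB))

  lastPiece-aa-other : ∀ x y → (A x , A y) ≢ (A m' , A m') → occ (A x , A y) (lastPieceM m' p) ≡ 0
  lastPiece-aa-other x y ne = trans (lastPiece-split (A x , A y))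
    (cong₂ _+_ (trans (block-nonAB {A x , A y} m' 0 (lastGapsM m' p) nAA)
                  (trans (occ-skip {A x , A y} {A m' , A m'} _ ne) (occ-excluded {A x , A y} IsBB _ (squareGaps-bb 1 p) aa-notBB)))
               (occ-excluded {A x , A y} IsBB _ (closingM-bb (suc p)) aa-notBB))

  lastPiece-aa-own : occ (A m' , A m') (lastPieceM m' p) ≡ 1
  lastPiece-aa-own = trans (lastPiece-split (A m' , A m'))
    (cong₂ _+_ (trans (block-nonAB {A m' , A m'} m' 0 (lastGapsM m' p) nAA)
                  (trans (occ-here (A m' , A m') _) (cong suc (occ-excluded {A m' , A m'} IsBB _ (squareGaps-bb 1 p) aa-notBB))))
               (occ-excluded {A m' , A m'} IsBB _ (closingM-bb (suc p)) aa-notBB))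

  lastPiece-bb : ∀ x y → x ≤ y → y ≤ suc p → occ (B x , B y) (lastPieceM m' p) ≡ 1
  lastPiece-bb x y xy yp = trans (lastPiece-split (B x , B y))
    (trans (cong (_+ occ (B x , B y) (closingM (suc p))) (block-nonAB {B x , B y} m' 0 (lastGapsM m' p) nBB)) (bbCount-lastM m' p x y xy yp))

  aa-from-owner : ∀ x y → UniqueOwnerM m' (A x , A y) → (A x , A y) ≢ (A m' , A m') → occ (A x , A y) route ≡ 1
  aa-from-owner x y (ℓ , ℓm , own , others) ne = route-block (A x , A y) ℓ ℓm (trans (blockCount-aa x y ℓ) own)
    (λ j jm jℓ → trans (blockCount-aa x y j) (others j jm jℓ)) (lastPiece-aa-other x y ne)

  occurs-onceM : ∀ c → CanM m' (suc p) c → occ c route ≡ 1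
  occurs-onceM (A x , B y) (cAB xm yq) =
    route-ab x y (ℕP.≤-pred xm) (ℕP.≤-pred yq) (λ { refl → lastPiece-ab-own y (ℕP.≤-pred yq) }) (lastPiece-ab-other x y)
  occurs-onceM (A x , A y) (cAA xy ym) with x ℕ.≟ y
  ... | no ne = aa-from-owner x y (ownerM-offdiagonal m' x y (ℕP.≤∧≢⇒< xy ne) (ℕP.≤-pred ym))
                  (λ e → ne (trans (A-inj (cong proj₁ e)) (≡-sym (A-inj (cong proj₂ e)))))
  ... | yes refl with x ℕ.≟ m'
  ...   | no ne = aa-from-owner x x (ownerM-diagonal m' x (ℕP.≤∧≢⇒< (ℕP.≤-pred ym) ne)) (λ e → ne (A-inj (cong proj₁ e)))
  ...   | yes refl = route-last (A x , A x) (λ j jm → trans (blockCount-aa x x j) (aaCountM-top m' j jm)) lastPiece-aa-own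
  occurs-onceM (B x , B y) (cBB xy yq) = route-bb x y (lastPiece-bb x y xy (ℕP.≤-pred yq))

-- Sizes of the bounce lists: block j bounces at most m'/2 times, so it fits into
-- the n'-1 gaps of the block as soon as m' + 1 ≤ 2n (m' + 1 ≤ 2(n-1) for M₂).
forwardPairs-length : ∀ j a k → length (forwardPairs j a k) ≡ k
forwardPairs-length j a zero = refl
forwardPairs-length j a (suc k) = cong suc (forwardPairs-length j (suc (suc a)) k)

backwardPairs-length : ∀ j z → length (backwardPairs j z) ≡ half z
backwardPairs-length j zero = refl
backwardPairs-length j (suc zero) = refl
backwardPairs-length j (suc (suc z)) = cong suc (backwardPairs-length j z)

forward+backward-length : ∀ m' j → length (forwardPairs j (3 + j) (forwardCount m' j) ++ backwardPairs j j) ≡ forwardCount m' j + half j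
forward+backward-length m' j = trans (LP.length-++ (forwardPairs j (3 + j) (forwardCount m' j)))
  (cong₂ _+_ (forwardPairs-length j _ _) (backwardPairs-length j j))

ownedF-length : ∀ m' j → j < m' → double (length (ownedF m' j)) ≤ m'
ownedF-length m' j jm with suc (suc j) ℕ.≤? m'
... | yes h = ℕP.≤-trans (ℕP.≤-reflexive (cong (λ z → suc (suc (double z))) (forward+backward-length m' j)))
      (ℕP.≤-trans (s≤s (s≤s (ℕP.≤-trans (ℕP.≤-reflexive (double-+ (forwardCount m' j) (half j))) (ℕP.+-mono-≤ (double-half _) (double-half j)))))
        (ℕP.≤-reflexive arith))
  where
  arith : suc (suc ((m' ∸ suc (suc j)) + j)) ≡ m'
  arith = trans (≡-sym (trans (ℕP.+-suc (m' ∸ suc (suc j)) (suc j)) (cong suc (ℕP.+-suc (m' ∸ suc (suc j)) j)))) (ℕP.m∸n+n≡m h)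
... | no nh with ℕP.≤-antisym jm (ℕP.≤-pred (ℕP.≰⇒> nh))
... | refl = ℕP.≤-trans
  (ℕP.≤-reflexive (cong double (trans (forward+backward-length (suc j) j) (cong (λ z → half z + half j) (ℕP.m≤n⇒m∸n≡0 (ℕP.n≤1+n j))))))
      (ℕP.≤-trans (double-half j) (ℕP.n≤1+n j))

ownedF-fits : ∀ m' p j → j < m' → suc m' ≤ 2 * suc (suc p) → length (ownedF m' j) ≤ suc p
ownedF-fits m' p j jm h = double≤1+double⇒≤ _ (suc p)
  (ℕP.≤-trans (ownedF-length m' j jm) (ℕP.≤-pred (subst (suc m' ≤_) (2*≡double (suc (suc p))) h)))

ownedM-fits : ∀ m' p j → j < m' → suc m' ≤ 2 * suc p → length (ownedM m' j) ≤ suc p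
ownedM-fits m' p j jm h = ℕP.≤-trans (ℕP.≤-reflexive (trans (LP.length-++ (ownedF m' j)) (ℕP.+-comm _ 1)))
  (s≤s (double≤1+double⇒≤ _ p (ℕP.≤-trans (ownedF-length m' j jm) (ℕP.≤-pred (subst (suc m' ≤_) (2*≡double (suc p)) h)))))

block-all : ∀ {P : Code → Set} i k gs → (∀ k' → k ≤ k' → k' ≤ blockEnd k gs → P (ab i k')) → All P (concat gs) → All P (block i k gs)
block-all i k [] h al = h k ℕP.≤-refl ℕP.≤-refl ∷ []
block-all {P} i k (g ∷ gs) h al = h k ℕP.≤-refl (blockEnd-≥ k gs) ∷ ++⁺ (++⁻ˡ g al)
   (block-all i (suc k) gs (λ k' a b → h k' (ℕP.≤-trans (ℕP.n≤1+n k) a) b) (++⁻ʳ g al))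
  where
  blockEnd-≥ : ∀ k gs → k ≤ blockEnd (suc k) gs
  blockEnd-≥ k [] = ℕP.n≤1+n k
  blockEnd-≥ k (_ ∷ gs) = ℕP.≤-trans (ℕP.n≤1+n k) (blockEnd-≥ (suc k) gs)

blockEnd-paddedGaps : ∀ r os → length os ≤ r → blockEnd 0 (paddedGaps (r ∸ length os) os) ≡ r
blockEnd-paddedGaps r os h = trans (blockEnd-length 0 (paddedGaps (r ∸ length os) os))
  (trans (paddedGaps-length (r ∸ length os) os) (ℕP.m+[n∸m]≡n h))

module CanonicalF (m' p : ℕ) where
  V : Code → Set
  V = CanF m' (suc p)

  topPair-can : ∀ j → All V (topPair m' j)
  topPair-can j with suc (suc j) ℕ.≤? m'
  ... | yes h = cAA (ℕP.<-trans (ℕP.n<1+n j) h) (ℕP.n<1+n m') ∷ []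
  ... | no _ = []

  forwardPairs-can : ∀ j a k → j < a → double k + a ≤ suc (suc m') → All V (forwardPairs j a k)
  forwardPairs-can j a zero ja h = []
  forwardPairs-can j a (suc k) ja (s≤s (s≤s h)) = cAA ja (s≤s (ℕP.≤-trans (ℕP.m≤n+m a (double k)) h)) ∷
    forwardPairs-can j (suc (suc a)) k (ℕP.m<n⇒m<1+n (ℕP.m<n⇒m<1+n ja))
      (ℕP.≤-trans (ℕP.≤-reflexive (trans (ℕP.+-suc (double k) (suc a)) (cong suc (ℕP.+-suc (double k) a)))) (s≤s (s≤s h)))

  backwardPairs-can : ∀ j z → z ≤ j → j < suc m' → All V (backwardPairs j z)
  backwardPairs-can j zero zj jm = []
  backwardPairs-can j (suc zero) zj jm = []
  backwardPairs-can j (suc (suc z)) zj jm = cAA (ℕP.≤-trans (ℕP.n≤1+n (suc z)) zj) jm ∷ backwardPairs-can j z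
    (ℕP.≤-trans (ℕP.≤-trans (ℕP.n≤1+n z) (ℕP.n≤1+n (suc z))) zj) jm

  forwardPairs-bound : ∀ j → j < m' → double (forwardCount m' j) + (3 + j) ≤ suc (suc m')
  forwardPairs-bound j jm with (3 + j) ℕ.≤? suc m'
  ... | yes h = ℕP.≤-trans (ℕP.+-monoˡ-≤ (3 + j) (double-half _)) (ℕP.≤-trans (ℕP.≤-reflexive (ℕP.m∸n+n≡m h)) (ℕP.n≤1+n _))
  ... | no nh = ℕP.≤-trans (ℕP.≤-reflexive (cong (λ z → double (half z) + (3 + j)) (ℕP.m≤n⇒m∸n≡0 (ℕP.<⇒≤ (ℕP.≰⇒> nh))))) (s≤s (s≤s jm))

  ownedF-can : ∀ j → j < m' → All V (ownedF m' j)
  ownedF-can j jm = ++⁺ (topPair-can j)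
    (++⁺ (forwardPairs-can j (3 + j) (forwardCount m' j) (ℕP.m≤n⇒m≤1+n (ℕP.m≤n⇒m≤1+n (ℕP.n<1+n j))) (forwardPairs-bound j jm))
                   (backwardPairs-can j j ℕP.≤-refl (ℕP.m<n⇒m<1+n jm)))

  open Route m' (suc p) (ownedF m') (ownedF-bounce m') (lastPieceF m' p)

  blocks-can : suc m' ≤ 2 * suc (suc p) → ∀ i d → d + i ≤ m' → All V (blocks i d)
  blocks-can hm i zero h = []
  blocks-can hm i (suc d) h = ++⁺
    (block-all i 0 (gapsOf i) (λ k' _ b → cAB (s≤s (ℕP.<⇒≤ im)) (s≤s (subst (k' ≤_) (blockEnd-paddedGaps (suc p) (ownedF m' i) (ownedF-fits m' p i im hm)) b)))
        (subst (All V) (≡-sym (concat-paddedGaps _ (ownedF m' i))) (ownedF-can i im)))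
     (cAA (ℕP.n<1+n i) (s≤s im) ∷ blocks-can hm (suc i) d (subst (_≤ m') (≡-sym (ℕP.+-suc d i)) h))
    where
    im : i < m'
    im = ℕP.≤-trans (s≤s (ℕP.m≤n+m i d)) h

  row-can : ∀ k f → f + k ≤ suc p → All V (row k f)
  row-can k zero h = []
  row-can k (suc f) h = cBB (s≤s (ℕP.m≤n+m k f)) (s≤s h) ∷ row-can k f (ℕP.≤-trans (ℕP.n≤1+n _) h)

  rowGaps-can : ∀ k f → f + k ≤ suc p → All V (concat (rowGaps k f))
  rowGaps-can k zero h = []
  rowGaps-can k (suc f) h = ++⁺ (row-can k (suc f) h) (rowGaps-can (suc k) f (subst (_≤ suc p) (≡-sym (ℕP.+-suc f k)) h))

  lastPiece-can : All V (lastPieceF m' p)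
  lastPiece-can = ++⁺
    (block-all m' 0 (lastGapsF p) (λ k' _ b → cAB ℕP.≤-refl (s≤s (subst (k' ≤_) (trans (lastGapsF-end p) (ℕP.+-identityʳ (suc p))) b)))
               (rowGaps-can 1 p (ℕP.≤-reflexive (ℕP.+-comm p 1))))
            (row-can 0 (suc p) (ℕP.≤-reflexive (ℕP.+-identityʳ (suc p))))

  route-canonicalF : suc m' ≤ 2 * suc (suc p) → All V route
  route-canonicalF hm = ++⁺ (blocks-can hm 0 m' (ℕP.≤-reflexive (ℕP.+-identityʳ m'))) lastPiece-can

data SortedB (d : ℕ) : Code → Set where
  sortedB : ∀ {a b} → a ≤ b → b ≤ d → SortedB d (B a , B b)

sortedB-mono : ∀ {d d' c} → d ≤ d' → SortedB d c → SortedB d' c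
sortedB-mono le (sortedB h1 h2) = sortedB h1 (ℕP.≤-trans h2 le)

colUp-sorted : ∀ L j f → f + j ≤ L → All (SortedB L) (colUp L j f)
colUp-sorted L j zero h = []
colUp-sorted L j (suc f) h = sortedB (ℕP.≤-trans (s≤s (ℕP.m≤n+m j f)) h) ℕP.≤-refl ∷ colUp-sorted L (suc j) f
  (subst (_≤ L) (≡-sym (ℕP.+-suc f j)) h)

colDown-sorted : ∀ L j → j ≤ L → All (SortedB L) (colDown L j)
colDown-sorted L zero h = []
colDown-sorted L (suc j) h = sortedB (ℕP.≤-trans (ℕP.n≤1+n j) h) ℕP.≤-refl ∷ colDown-sorted L j (ℕP.≤-trans (ℕP.n≤1+n j) h)

snake-sorted : ∀ h → All (SortedB (double h)) (snake h)
snake-sorted zero = sortedB z≤n z≤n ∷ []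
snake-sorted (suc h) = sortedB z≤n ℕP.≤-refl ∷ ++⁺
  (colUp-sorted _ 0 (double h) (ℕP.≤-trans (ℕP.≤-reflexive (ℕP.+-identityʳ (double h))) (ℕP.≤-trans (ℕP.n≤1+n _) (ℕP.n≤1+n _))))
  (sortedB (ℕP.n≤1+n _) (ℕP.n≤1+n _) ∷ ++⁺ (All.map (sortedB-mono (ℕP.n≤1+n _)) (colDown-sorted _ (double h) (ℕP.n≤1+n _)))
    (All.map (sortedB-mono (ℕP.≤-trans (ℕP.n≤1+n _) (ℕP.n≤1+n _))) (snake-sorted h)))

closingM-sorted : ∀ n' → All (SortedB n') (closingM n')
closingM-sorted n' with parity n'
... | even zero = []
... | even (suc h) = snake-sorted (suc h)
... | odd h = sortedB ℕP.≤-refl ℕP.≤-refl ∷ ++⁺ (colDown-sorted _ (suc (double h)) ℕP.≤-refl)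
  (All.map (sortedB-mono (ℕP.n≤1+n _)) (snake-sorted h))

module CanonicalM (m' p : ℕ) where
  V : Code → Set
  V = CanM m' (suc p)

  canF⇒canM : ∀ {c} → CanF m' (suc p) c → V c
  canF⇒canM (cAA a b) = cAA (ℕP.<⇒≤ a) b
  canF⇒canM (cAB a b) = cAB a b
  canF⇒canM (cBB a b) = cBB (ℕP.<⇒≤ a) b

  ownedM-can : ∀ j → j < m' → All V (ownedM m' j)
  ownedM-can j jm = ++⁺ (All.map canF⇒canM (CanonicalF.ownedF-can m' p j jm)) (cAA ℕP.≤-refl (ℕP.m<n⇒m<1+n jm) ∷ [])

  open Route m' (suc p) (ownedM m') (ownedM-bounce m') (lastPieceM m' p)

  blocks-can : suc m' ≤ 2 * suc p → ∀ i d → d + i ≤ m' → All V (blocks i d)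
  blocks-can hm i zero h = []
  blocks-can hm i (suc d) h = ++⁺
    (block-all i 0 (gapsOf i) (λ k' _ b → cAB (s≤s (ℕP.<⇒≤ im)) (s≤s (subst (k' ≤_) (blockEnd-paddedGaps (suc p) (ownedM m' i) (ownedM-fits m' p i im hm)) b)))
        (subst (All V) (≡-sym (concat-paddedGaps _ (ownedM m' i))) (ownedM-can i im)))
     (cAA (ℕP.n≤1+n i) (s≤s im) ∷ blocks-can hm (suc i) d (subst (_≤ m') (≡-sym (ℕP.+-suc d i)) h))
    where
    im : i < m'
    im = ℕP.≤-trans (s≤s (ℕP.m≤n+m i d)) h

  squareGaps-can : ∀ k f → f + k ≤ suc p → All V (concat (squareGaps k f))
  squareGaps-can k zero h = []
  squareGaps-can k (suc zero) h = cBB ℕP.≤-refl (s≤s k1) ∷ cBB (ℕP.n≤1+n k) (s≤s h) ∷ cBB ℕP.≤-refl (s≤s h) ∷ []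
    where k1 = ℕP.≤-trans (ℕP.n≤1+n k) h
  squareGaps-can k (suc (suc f)) h = cBB ℕP.≤-refl (s≤s k1) ∷ cBB (ℕP.n≤1+n k) (s≤s k2) ∷ cBB ℕP.≤-refl (s≤s k2) ∷
      squareGaps-can (suc (suc k)) f (ℕP.≤-trans (ℕP.≤-reflexive (trans (ℕP.+-suc f (suc k)) (cong suc (ℕP.+-suc f k)))) h)
    where
    k2 : suc k ≤ suc p
    k2 = ℕP.≤-trans (s≤s (ℕP.m≤n+m k (suc f))) h
    k1 = ℕP.≤-trans (ℕP.n≤1+n k) k2

  lastPiece-can : All V (lastPieceM m' p)
  lastPiece-can = ++⁺ (block-all m' 0 (lastGapsM m' p) (λ k' _ b → cAB ℕP.≤-refl (s≤s (subst (k' ≤_) (lastGapsM-end m' p) b)))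
               (cAA ℕP.≤-refl ℕP.≤-refl ∷ squareGaps-can 1 p (ℕP.≤-reflexive (ℕP.+-comm p 1))))
            (All.map (λ { (sortedB a b) → cBB a (s≤s b) }) (closingM-sorted (suc p)))

  route-canonicalM : suc m' ≤ 2 * suc p → All V route
  route-canonicalM hm = ++⁺ (blocks-can hm 0 m' (ℕP.≤-reflexive (ℕP.+-identityʳ m'))) lastPiece-can

occ-three-distinct : ∀ a b c L → a ≢ b → a ≢ c → b ≢ c → occ a L + (occ b L + occ c L) ≤ length L
occ-three-distinct a b c [] _ _ _ = z≤n
occ-three-distinct a b c (x ∷ L) ab ac bc with a ≟c x | b ≟c x | c ≟c x
... | yes refl | yes refl | _ = ⊥-elim (ab refl)
... | yes refl | _ | yes refl = ⊥-elim (ac refl)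
... | _ | yes refl | yes refl = ⊥-elim (bc refl)
... | yes _ | no _ | no _ = s≤s (occ-three-distinct a b c L ab ac bc)
... | no _ | yes _ | no _ = ℕP.≤-trans (ℕP.≤-reflexive (ℕP.+-suc (occ a L) _)) (s≤s (occ-three-distinct a b c L ab ac bc))
... | no _ | no _ | yes _ = ℕP.≤-trans
  (ℕP.≤-reflexive (trans (cong (occ a L +_) (ℕP.+-suc (occ b L) _)) (ℕP.+-suc (occ a L) _)))
  (s≤s (occ-three-distinct a b c L ab ac bc))
... | no _ | no _ | no _ = ℕP.≤-trans (occ-three-distinct a b c L ab ac bc) (ℕP.n≤1+n _)

length≥3 : ∀ a b c L → a ≢ b → a ≢ c → b ≢ c → occ a L ≡ 1 → occ b L ≡ 1 → occ c L ≡ 1 → 3 ≤ length L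
length≥3 a b c L ab ac bc ha hb hc = subst (_≤ length L) (cong₂ _+_ ha (cong₂ _+_ hb hc)) (occ-three-distinct a b c L ab ac bc)

tourF : ∀ m' p → suc m' ≤ 2 * suc (suc p) → Tour CodeAdj _≟c_ (CanF m' (suc p))
tourF m' p bound = record
  { walk = proj₁ (proj₂ closed)
  ; closing = proj₂ (proj₂ closed)
  ; canonical = CanonicalF.route-canonicalF m' p bound
  ; once = occurs-onceF
  ; long = length≥3 (A 0 , B 0) (A 0 , B 1) (B 0 , B 1) route (λ ()) (λ ()) (λ ())
      (occurs-onceF _ (cAB (s≤s z≤n) (s≤s z≤n))) (occurs-onceF _ (cAB (s≤s z≤n) (s≤s (s≤s z≤n))))
      (occurs-onceF _ (cBB (s≤s z≤n) (s≤s (s≤s z≤n))))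
  }
  where
  open Route m' (suc p) (ownedF m') (ownedF-bounce m') (lastPieceF m' p)
  open CountingF m' p
  closed : Σ Code λ l → Walk (ab 0 0) l route × CodeAdj l (ab 0 0)
  closed = route-walk (lastPieceF-walk m' p)

tourM : ∀ m' p → suc m' ≤ 2 * suc p → Tour CodeAdj _≟c_ (CanM m' (suc p))
tourM m' p bound = record
  { walk = proj₁ (proj₂ closed)
  ; closing = proj₂ (proj₂ closed)
  ; canonical = CanonicalM.route-canonicalM m' p bound
  ; once = occurs-onceM
  ; long = length≥3 (A 0 , B 0) (A 0 , B 1) (B 0 , B 1) route (λ ()) (λ ()) (λ ())
      (occurs-onceM _ (cAB (s≤s z≤n) (s≤s z≤n))) (occurs-onceM _ (cAB (s≤s z≤n) (s≤s (s≤s z≤n))))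
      (occurs-onceM _ (cBB z≤n (s≤s (s≤s z≤n))))
  }
  where
  open Route m' (suc p) (ownedM m') (ownedM-bounce m') (lastPieceM m' p)
  open CountingM m' p
  closed : Σ Code λ l → Walk (ab 0 0) l route × CodeAdj l (ab 0 0)
  closed = route-walk (lastPieceM-walk m' p)

-- The element of Fin (suc K) with value i, truncated at K.
clamp : ∀ {K} → ℕ → Fin (suc K)
clamp {K} zero = F.zero
clamp {zero} (suc i) = F.zero
clamp {suc K} (suc i) = F.suc (clamp i)

toℕ-clamp : ∀ {K} i → i ≤ K → toℕ (clamp {K} i) ≡ i
toℕ-clamp {K} zero h = refl
toℕ-clamp {suc K} (suc i) (s≤s h) = cong suc (toℕ-clamp i h)

clamp-toℕ : ∀ {K} (i : Fin (suc K)) → clamp (toℕ i) ≡ i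
clamp-toℕ {K} i = FP.toℕ-injective (toℕ-clamp (toℕ i) (ℕP.≤-pred (FP.toℕ<n i)))

listing-size : ∀ {a b} → Listing a (Fin b) → a ≡ b
listing-size f = FP.cantor-schröder-bernstein (Bijection.injective f) from-injective
  where
  from : _ → _
  from y = proj₁ (Bijection.surjective f y)
  to-from : ∀ y → Bijection.to f (from y) ≡ y
  to-from y = proj₂ (Bijection.surjective f y) refl
  from-injective : ∀ {x y} → from x ≡ from y → x ≡ y
  from-injective {x} {y} e = trans (≡-sym (to-from x)) (trans (cong (Bijection.to f) e) (to-from y))

-- Sorting a code: the order a₀ < a₁ < … < b₀ < b₁ < … on symbolic vertices,
-- and the code with its two entries put in this order.
data _⊑_ : Vtx → Vtx → Set where
  a⊑a : ∀ {i j} → i ≤ j → A i ⊑ A j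
  a⊑b : ∀ {i j} → A i ⊑ B j
  b⊑b : ∀ {i j} → i ≤ j → B i ⊑ B j

_⊑?_ : ∀ u v → Dec (u ⊑ v)
A i ⊑? A j with i ℕ.≤? j
... | yes p = yes (a⊑a p)
... | no p = no (λ { (a⊑a q) → p q })
A i ⊑? B j = yes a⊑b
B i ⊑? A j = no (λ ())
B i ⊑? B j with i ℕ.≤? j
... | yes p = yes (b⊑b p)
... | no p = no (λ { (b⊑b q) → p q })

⊑-antisym : ∀ {u v} → u ⊑ v → v ⊑ u → u ≡ v
⊑-antisym (a⊑a p) (a⊑a q) = cong A (ℕP.≤-antisym p q)
⊑-antisym (b⊑b p) (b⊑b q) = cong B (ℕP.≤-antisym p q)

⋢⇒⊒ : ∀ u v → ¬ u ⊑ v → v ⊑ u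
⋢⇒⊒ (A i) (A j) ne = a⊑a (ℕP.≰⇒≥ (λ h → ne (a⊑a h)))
⋢⇒⊒ (A i) (B j) ne = ⊥-elim (ne a⊑b)
⋢⇒⊒ (B i) (A j) ne = a⊑b
⋢⇒⊒ (B i) (B j) ne = b⊑b (ℕP.≰⇒≥ (λ h → ne (b⊑b h)))

sortCode : Code → Code
sortCode (u , v) with u ⊑? v
... | yes _ = (u , v)
... | no _ = (v , u)

sortCode-swap : ∀ u v → sortCode (u , v) ≡ sortCode (v , u)
sortCode-swap u v with u ⊑? v | v ⊑? u
... | yes p | yes q rewrite ⊑-antisym p q = refl
... | yes p | no q = refl
... | no p | yes q = refl
... | no p | no q = ⊥-elim (q (⋢⇒⊒ u v p))

sortCode-sorted : ∀ {u v} → u ⊑ v → sortCode (u , v) ≡ (u , v)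
sortCode-sorted {u} {v} le with u ⊑? v
... | yes _ = refl
... | no ne = ⊥-elim (ne le)

sortCode-cases : ∀ u v → (sortCode (u , v) ≡ (u , v)) ⊎ (sortCode (u , v) ≡ (v , u))
sortCode-cases u v with u ⊑? v
... | yes _ = inj₁ refl
... | no _ = inj₂ refl

same-under : ∀ {N} {x y : Fin N} (ι : Vtx → Fin N) {c₁ c₂ z a : Vtx} →
  SamePair x y (ι c₁) (ι c₂) → SameCode (c₁ , c₂) (z , a) → SamePair x y (ι z) (ι a)
same-under ι (inj₁ (p , q)) (inj₁ (refl , refl)) = inj₁ (p , q)
same-under ι (inj₁ (p , q)) (inj₂ (refl , refl)) = inj₂ (p , q)
same-under ι (inj₂ (p , q)) (inj₁ (refl , refl)) = inj₂ (p , q)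
same-under ι (inj₂ (p , q)) (inj₂ (refl , refl)) = inj₁ (p , q)

same-code-both : ∀ {c₁ c₂ z a : Vtx} {P : Vtx → Set} → SameCode (c₁ , c₂) (z , a) →
  P c₁ → P c₂ → P z × P a
same-code-both (inj₁ (refl , refl)) h₁ h₂ = h₁ , h₂
same-code-both (inj₂ (refl , refl)) h₁ h₂ = h₂ , h₁

-- The model inside G₁ + G₂, where |G₁| = m'+1 and G₂ has the Hamiltonian path
-- π 0, …, π q through its q+1 vertices: aᵢ ↦ i-th vertex of G₁, bⱼ ↦ π j.
module Embedding (m' q : ℕ) (G₁ : Graph (suc m')) (G₂ : Graph (suc q))
  (f : Listing (suc q) (Fin (suc q)))
  (path : ∀ (i : Fin q) → Adj G₂ (Bijection.to f (inject₁ i)) (Bijection.to f (F.suc i))) where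

  n N : ℕ
  n = suc q
  N = suc m' + n

  J : Fin N → Fin N → Set
  J = JoinAdj G₁ G₂

  π : Fin n → Fin n
  π = Bijection.to f

  π⁻¹ : Fin n → Fin n
  π⁻¹ y = proj₁ (Bijection.surjective f y)

  π-π⁻¹ : ∀ y → π (π⁻¹ y) ≡ y
  π-π⁻¹ y = proj₂ (Bijection.surjective f y) refl

  π⁻¹-π : ∀ x → π⁻¹ (π x) ≡ x
  π⁻¹-π x = Bijection.injective f (π-π⁻¹ (π x))

  ι : Vtx → Fin N
  ι (A i) = clamp i ↑ˡ n
  ι (B j) = suc m' ↑ʳ π (clamp j)

  InRange : Vtx → Set
  InRange (A i) = i < suc m'
  InRange (B j) = j < n

  ι⁻¹ : Fin N → Vtx
  ι⁻¹ x with splitAt (suc m') x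
  ... | inj₁ i = A (toℕ i)
  ... | inj₂ j = B (toℕ (π⁻¹ j))

  ι⁻¹-ι : ∀ u → InRange u → ι⁻¹ (ι u) ≡ u
  ι⁻¹-ι (A i) h rewrite FP.splitAt-↑ˡ (suc m') (clamp {m'} i) n = cong A (toℕ-clamp i (ℕP.≤-pred h))
  ι⁻¹-ι (B j) h rewrite FP.splitAt-↑ʳ (suc m') n (π (clamp {q} j)) | π⁻¹-π (clamp {q} j) =
    cong B (toℕ-clamp j (ℕP.≤-pred h))

  join-split : ∀ {x s} → splitAt (suc m') x ≡ s → join (suc m') n s ≡ x
  join-split {x} eq = trans (cong (join (suc m') n) (≡-sym eq)) (FP.join-splitAt (suc m') n x)

  ι-ι⁻¹ : ∀ x → ι (ι⁻¹ x) ≡ x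
  ι-ι⁻¹ x with splitAt (suc m') x in eq
  ... | inj₁ i = trans (cong (_↑ˡ n) (clamp-toℕ i)) (join-split eq)
  ... | inj₂ j = trans (cong (λ z → suc m' ↑ʳ π z) (clamp-toℕ (π⁻¹ j)))
                   (trans (cong (suc m' ↑ʳ_) (π-π⁻¹ j)) (join-split eq))

  InRange-ι⁻¹ : ∀ x → InRange (ι⁻¹ x)
  InRange-ι⁻¹ x with splitAt (suc m') x
  ... | inj₁ i = FP.toℕ<n i
  ... | inj₂ j = FP.toℕ<n (π⁻¹ j)

  ι-injective : ∀ {u v} → InRange u → InRange v → ι u ≡ ι v → u ≡ v
  ι-injective {u} {v} hu hv e = trans (≡-sym (ι⁻¹-ι u hu)) (trans (cong ι⁻¹ e) (ι⁻¹-ι v hv))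

  join-ab : (a : Fin (suc m')) (b : Fin n) → J (a ↑ˡ n) (suc m' ↑ʳ b)
  join-ab a b rewrite FP.splitAt-↑ˡ (suc m') a n | FP.splitAt-↑ʳ (suc m') n b = tt

  join-ba : (a : Fin (suc m')) (b : Fin n) → J (suc m' ↑ʳ b) (a ↑ˡ n)
  join-ba a b rewrite FP.splitAt-↑ˡ (suc m') a n | FP.splitAt-↑ʳ (suc m') n b = tt

  join-bb : (a b : Fin n) → Adj G₂ a b → J (suc m' ↑ʳ a) (suc m' ↑ʳ b)
  join-bb a b e rewrite FP.splitAt-↑ʳ (suc m') n a | FP.splitAt-↑ʳ (suc m') n b = e

  path-step : ∀ j → suc j < n → Adj G₂ (π (clamp j)) (π (clamp (suc j)))
  path-step j (s≤s h) = subst₂ (λ a b → Adj G₂ (π a) (π b)) here next (path k)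
    where
    k : Fin q
    k = fromℕ< h
    here : inject₁ k ≡ clamp j
    here = FP.toℕ-injective (trans (FP.toℕ-inject₁ k) (trans (FP.toℕ-fromℕ< h)
             (≡-sym (toℕ-clamp j (ℕP.≤-trans (ℕP.n≤1+n j) h)))))
    next : F.suc k ≡ clamp (suc j)
    next = FP.toℕ-injective (trans (cong suc (FP.toℕ-fromℕ< h)) (≡-sym (toℕ-clamp (suc j) h)))

  edge-ι : ∀ {a b} → Edge a b → InRange a → InRange b → J (ι a) (ι b)
  edge-ι (ab-edge {i} {j}) ha hb = join-ab (clamp i) (π (clamp j))
  edge-ι (ba-edge {i} {j}) ha hb = join-ba (clamp i) (π (clamp j))
  edge-ι (up-edge {j}) ha hb = join-bb _ _ (path-step j hb)
  edge-ι (down-edge {j}) ha hb = join-bb _ _ (Graph.sym G₂ (path-step j ha))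

module F₂Coding (m' q : ℕ) (G₁ : Graph (suc m')) (G₂ : Graph (suc q))
  (f : Listing (suc q) (Fin (suc q)))
  (path : ∀ (i : Fin q) → Adj G₂ (Bijection.to f (inject₁ i)) (Bijection.to f (F.suc i))) where
  open Embedding m' q G₁ G₂ f path

  V : Set
  V = F₂V N

  -- Some vertex of F₂, the value of the (never used) diagonal pair below.
  some-pair : V
  some-pair = (F.zero ↑ˡ n , suc m' ↑ʳ F.zero) , s≤s z≤n

  -- The sorted pair {x,y} for x ≠ y.
  pair : Fin N → Fin N → V
  pair x y with FP.<-cmp x y
  ... | tri< lt _ _ = (x , y) , lt
  ... | tri≈ _ _ _ = some-pair
  ... | tri> _ _ gt = (y , x) , gt

  pair-same : ∀ x y → x ≢ y → SamePair (proj₁ (proj₁ (pair x y))) (proj₂ (proj₁ (pair x y))) x y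
  pair-same x y ne with FP.<-cmp x y
  ... | tri< _ _ _ = inj₁ (refl , refl)
  ... | tri≈ _ e _ = ⊥-elim (ne e)
  ... | tri> _ _ _ = inj₂ (refl , refl)

  pair-cases : ∀ x y → x ≢ y → (proj₁ (pair x y) ≡ (x , y)) ⊎ (proj₁ (pair x y) ≡ (y , x))
  pair-cases x y ne with FP.<-cmp x y
  ... | tri< _ _ _ = inj₁ refl
  ... | tri≈ _ e _ = ⊥-elim (ne e)
  ... | tri> _ _ _ = inj₂ refl

  pair-sorted : ∀ x y (lt : x F.< y) → pair x y ≡ ((x , y) , lt)
  pair-sorted x y lt with FP.<-cmp x y
  ... | tri< lt' _ _ = cong (λ r → (x , y) , r) (FP.<-irrelevant lt' lt)
  ... | tri≈ nlt _ _ = ⊥-elim (nlt lt)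
  ... | tri> nlt _ _ = ⊥-elim (nlt lt)

  pair-swapped : ∀ x y (lt : x F.< y) → pair y x ≡ ((x , y) , lt)
  pair-swapped x y lt with FP.<-cmp y x
  ... | tri< lt' _ _ = ⊥-elim (ℕP.<-asym lt lt')
  ... | tri≈ _ e _ = ⊥-elim (ℕP.<-irrefl (cong toℕ (≡-sym e)) lt)
  ... | tri> _ _ gt = cong (λ r → (x , y) , r) (FP.<-irrelevant gt lt)

  _≟V_ : DecidableEquality V
  ((x , y) , p) ≟V ((x' , y') , p') with x FP.≟ x' | y FP.≟ y'
  ... | yes refl | yes refl = yes (cong (λ r → (x , y) , r) (FP.<-irrelevant p p'))
  ... | no ne | _ = no (λ e → ne (cong (λ v → proj₁ (proj₁ v)) e))
  ... | yes _ | no ne = no (λ e → ne (cong (λ v → proj₂ (proj₁ v)) e))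

  enc : Code → V
  enc (u , v) = pair (ι u) (ι v)

  dec : V → Code
  dec ((x , y) , _) = sortCode (ι⁻¹ x , ι⁻¹ y)

  Can : Code → Set
  Can = CanF m' q

  can-range : ∀ {u v} → Can (u , v) → InRange u × InRange v
  can-range (cAA p q) = ℕP.<-trans p q , q
  can-range (cAB p q) = p , q
  can-range (cBB p q) = ℕP.<-trans p q , q

  can-sorted : ∀ {u v} → Can (u , v) → u ⊑ v
  can-sorted (cAA p q) = a⊑a (ℕP.<⇒≤ p)
  can-sorted (cAB p q) = a⊑b
  can-sorted (cBB p q) = b⊑b (ℕP.<⇒≤ p)

  can-ι-distinct : ∀ {u v} → Can (u , v) → ι u ≢ ι v
  can-ι-distinct c e with ι-injective (proj₁ (can-range c)) (proj₂ (can-range c)) e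
  can-ι-distinct (cAA p q) e | refl = ℕP.<-irrefl refl p
  can-ι-distinct (cBB p q) e | refl = ℕP.<-irrefl refl p

  dec-enc : ∀ {c} → Can c → dec (enc c) ≡ c
  dec-enc {u , v} c with pair-cases (ι u) (ι v) (can-ι-distinct c)
  ... | inj₁ e = trans (cong (λ p → sortCode (ι⁻¹ (proj₁ p) , ι⁻¹ (proj₂ p))) e)
                   (trans (cong₂ (λ a b → sortCode (a , b)) (ι⁻¹-ι u (proj₁ (can-range c))) (ι⁻¹-ι v (proj₂ (can-range c))))
                     (sortCode-sorted (can-sorted c)))
  ... | inj₂ e = trans (cong (λ p → sortCode (ι⁻¹ (proj₁ p) , ι⁻¹ (proj₂ p))) e)
                   (trans (cong₂ (λ a b → sortCode (a , b)) (ι⁻¹-ι v (proj₂ (can-range c))) (ι⁻¹-ι u (proj₁ (can-range c))))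
                     (trans (sortCode-swap v u) (sortCode-sorted (can-sorted c))))

  enc-dec : ∀ v → enc (dec v) ≡ v
  enc-dec ((x , y) , lt) with sortCode-cases (ι⁻¹ x) (ι⁻¹ y)
  ... | inj₁ e rewrite e | ι-ι⁻¹ x | ι-ι⁻¹ y = pair-sorted x y lt
  ... | inj₂ e rewrite e | ι-ι⁻¹ x | ι-ι⁻¹ y = pair-swapped x y lt

  can-sort : ∀ u v → InRange u → InRange v → u ≢ v → Can (sortCode (u , v))
  can-sort u v hu hv ne with u ⊑? v
  can-sort (A i) (A j) hu hv ne | yes (a⊑a p) = cAA (ℕP.≤∧≢⇒< p (λ e → ne (cong A e))) hv
  can-sort (A i) (B j) hu hv ne | yes a⊑b = cAB hu hv
  can-sort (B i) (B j) hu hv ne | yes (b⊑b p) = cBB (ℕP.≤∧≢⇒< p (λ e → ne (cong B e))) hv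
  can-sort (A i) (A j) hu hv ne | no p = cAA (ℕP.≰⇒> (λ h → p (a⊑a h))) hu
  can-sort (A i) (B j) hu hv ne | no p = ⊥-elim (p a⊑b)
  can-sort (B i) (A j) hu hv ne | no p = cAB hv hu
  can-sort (B i) (B j) hu hv ne | no p = cBB (ℕP.≰⇒> (λ h → p (b⊑b h))) hu

  can-dec : ∀ v → Can (dec v)
  can-dec ((x , y) , lt) = can-sort (ι⁻¹ x) (ι⁻¹ y) (InRange-ι⁻¹ x) (InRange-ι⁻¹ y)
    (λ e → ℕP.<-irrefl (cong toℕ (trans (≡-sym (ι-ι⁻¹ x)) (trans (cong ι e) (ι-ι⁻¹ y)))) lt)

  enc-adj : ∀ {c d} → CodeAdj c d → Can c → Can d → F₂Adj J (enc c) (enc d)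
  enc-adj {c₁ , c₂} {d₁ , d₂} (z , a , b , e , s₁ , s₂) hc hd =
    ι z , ι a , ι b , edge-ι e (proj₂ (same-code-both s₁ (proj₁ (can-range hc)) (proj₂ (can-range hc))))
                               (proj₂ (same-code-both s₂ (proj₁ (can-range hd)) (proj₂ (can-range hd)))) ,
    same-under ι (pair-same (ι c₁) (ι c₂) (can-ι-distinct hc)) s₁ ,
    same-under ι (pair-same (ι d₁) (ι d₂) (can-ι-distinct hd)) s₂

  open Transport _≟c_ _≟V_ {RV = F₂Adj J} enc dec dec-enc enc-dec can-dec enc-adj public

module M₂Coding (m' q : ℕ) (G₁ : Graph (suc m')) (G₂ : Graph (suc q))
  (f : Listing (suc q) (Fin (suc q)))
  (path : ∀ (i : Fin q) → Adj G₂ (Bijection.to f (inject₁ i)) (Bijection.to f (F.suc i))) where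
  open Embedding m' q G₁ G₂ f path

  V : Set
  V = M₂V N

  pair : Fin N → Fin N → V
  pair x y with FP.<-cmp x y
  ... | tri< lt _ _ = (x , y) , ℕP.<⇒≤ lt
  ... | tri≈ _ e _ = (x , y) , ℕP.≤-reflexive (cong toℕ e)
  ... | tri> _ _ gt = (y , x) , ℕP.<⇒≤ gt

  pair-same : ∀ x y → SamePair (proj₁ (proj₁ (pair x y))) (proj₂ (proj₁ (pair x y))) x y
  pair-same x y with FP.<-cmp x y
  ... | tri< _ _ _ = inj₁ (refl , refl)
  ... | tri≈ _ e _ = inj₁ (refl , refl)
  ... | tri> _ _ _ = inj₂ (refl , refl)

  pair-cases : ∀ x y → (proj₁ (pair x y) ≡ (x , y)) ⊎ (proj₁ (pair x y) ≡ (y , x))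
  pair-cases x y with FP.<-cmp x y
  ... | tri< _ _ _ = inj₁ refl
  ... | tri≈ _ e _ = inj₁ refl
  ... | tri> _ _ _ = inj₂ refl

  pair-sorted : ∀ x y (le : x F.≤ y) → pair x y ≡ ((x , y) , le)
  pair-sorted x y le with FP.<-cmp x y
  ... | tri< _ _ _ = cong (λ r → (x , y) , r) (FP.≤-irrelevant _ le)
  ... | tri≈ _ _ _ = cong (λ r → (x , y) , r) (FP.≤-irrelevant _ le)
  ... | tri> _ _ gt = ⊥-elim (ℕP.<⇒≱ gt le)

  pair-swapped : ∀ x y (le : x F.≤ y) → pair y x ≡ ((x , y) , le)
  pair-swapped x y le with FP.<-cmp y x
  ... | tri< lt _ _ = ⊥-elim (ℕP.<⇒≱ lt le)
  ... | tri≈ _ refl _ = cong (λ r → (x , x) , r) (FP.≤-irrelevant _ le)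
  ... | tri> _ _ _ = cong (λ r → (x , y) , r) (FP.≤-irrelevant _ le)

  _≟V_ : DecidableEquality V
  ((x , y) , p) ≟V ((x' , y') , p') with x FP.≟ x' | y FP.≟ y'
  ... | yes refl | yes refl = yes (cong (λ r → (x , y) , r) (FP.≤-irrelevant p p'))
  ... | no ne | _ = no (λ e → ne (cong (λ v → proj₁ (proj₁ v)) e))
  ... | yes _ | no ne = no (λ e → ne (cong (λ v → proj₂ (proj₁ v)) e))

  enc : Code → V
  enc (u , v) = pair (ι u) (ι v)

  dec : V → Code
  dec ((x , y) , _) = sortCode (ι⁻¹ x , ι⁻¹ y)

  Can : Code → Set
  Can = CanM m' q

  can-range : ∀ {u v} → Can (u , v) → InRange u × InRange v
  can-range (cAA p q) = ℕP.≤-<-trans p q , q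
  can-range (cAB p q) = p , q
  can-range (cBB p q) = ℕP.≤-<-trans p q , q

  can-sorted : ∀ {u v} → Can (u , v) → u ⊑ v
  can-sorted (cAA p q) = a⊑a p
  can-sorted (cAB p q) = a⊑b
  can-sorted (cBB p q) = b⊑b p

  dec-enc : ∀ {c} → Can c → dec (enc c) ≡ c
  dec-enc {u , v} c with pair-cases (ι u) (ι v)
  ... | inj₁ e = trans (cong (λ p → sortCode (ι⁻¹ (proj₁ p) , ι⁻¹ (proj₂ p))) e)
                   (trans (cong₂ (λ a b → sortCode (a , b)) (ι⁻¹-ι u (proj₁ (can-range c))) (ι⁻¹-ι v (proj₂ (can-range c))))
                     (sortCode-sorted (can-sorted c)))
  ... | inj₂ e = trans (cong (λ p → sortCode (ι⁻¹ (proj₁ p) , ι⁻¹ (proj₂ p))) e)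
                   (trans (cong₂ (λ a b → sortCode (a , b)) (ι⁻¹-ι v (proj₂ (can-range c))) (ι⁻¹-ι u (proj₁ (can-range c))))
                     (trans (sortCode-swap v u) (sortCode-sorted (can-sorted c))))

  enc-dec : ∀ v → enc (dec v) ≡ v
  enc-dec ((x , y) , le) with sortCode-cases (ι⁻¹ x) (ι⁻¹ y)
  ... | inj₁ e rewrite e | ι-ι⁻¹ x | ι-ι⁻¹ y = pair-sorted x y le
  ... | inj₂ e rewrite e | ι-ι⁻¹ x | ι-ι⁻¹ y = pair-swapped x y le

  can-sort : ∀ u v → InRange u → InRange v → Can (sortCode (u , v))
  can-sort u v hu hv with u ⊑? v
  can-sort (A i) (A j) hu hv | yes (a⊑a p) = cAA p hv
  can-sort (A i) (B j) hu hv | yes a⊑b = cAB hu hv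
  can-sort (B i) (B j) hu hv | yes (b⊑b p) = cBB p hv
  can-sort (A i) (A j) hu hv | no p = cAA (ℕP.<⇒≤ (ℕP.≰⇒> (λ h → p (a⊑a h)))) hu
  can-sort (A i) (B j) hu hv | no p = ⊥-elim (p a⊑b)
  can-sort (B i) (A j) hu hv | no p = cAB hv hu
  can-sort (B i) (B j) hu hv | no p = cBB (ℕP.<⇒≤ (ℕP.≰⇒> (λ h → p (b⊑b h)))) hu

  can-dec : ∀ v → Can (dec v)
  can-dec ((x , y) , _) = can-sort (ι⁻¹ x) (ι⁻¹ y) (InRange-ι⁻¹ x) (InRange-ι⁻¹ y)

  enc-adj : ∀ {c d} → CodeAdj c d → Can c → Can d → M₂Adj J (enc c) (enc d)
  enc-adj {c₁ , c₂} {d₁ , d₂} (z , a , b , e , s₁ , s₂) hc hd =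
    ι z , ι a , ι b , edge-ι e (proj₂ (same-code-both s₁ (proj₁ (can-range hc)) (proj₂ (can-range hc))))
                               (proj₂ (same-code-both s₂ (proj₁ (can-range hd)) (proj₂ (can-range hd)))) ,
    same-under ι (pair-same (ι c₁) (ι c₂)) s₁ ,
    same-under ι (pair-same (ι d₁) (ι d₂)) s₂

  open Transport _≟c_ _≟V_ {RV = M₂Adj J} enc dec dec-enc enc-dec can-dec enc-adj public

-- The Hamiltonian path of G₂ lists all n vertices, so n = q+1 with q ≥ 1.
-- Writing m = m'+1 and n = p+2, the bounds on m are exactly the hypotheses of
-- tourF and tourM, and the model tours transport to G₁ + G₂.
corollary1 : ∀ (m n : ℕ) (G₁ : Graph m) (G₂ : Graph n) →
    1 ≤ m → 2 ≤ n → HamiltonianPath (Adj G₂) →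
    (m ≤ 2 * n → Hamiltonian (F₂Adj (JoinAdj G₁ G₂)))
    × (m ≤ 2 * (n ∸ 1) → Hamiltonian (M₂Adj (JoinAdj G₁ G₂)))
corollary1 zero n G₁ G₂ () _ _
corollary1 (suc m') n G₁ G₂ _ n≥2 (q , f , path) with listing-size f
corollary1 (suc m') .1 G₁ G₂ _ (s≤s ()) (zero , f , path) | refl
corollary1 (suc m') .(suc (suc p)) G₁ G₂ _ _ (suc p , f , path) | refl =
  (λ bound → F₂Coding.transport-hamiltonian m' (suc p) G₁ G₂ f path (tourF m' p bound)) ,
  (λ bound → M₂Coding.transport-hamiltonian m' (suc p) G₁ G₂ f path (tourM m' p bound))
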